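{- Let $a,b$ be integral weight functions on $\mathcal{F}$ with weights $\omega_a,\omega_b\in\mathbb{Z}_{\ge0}$. Then $$\langle a,b\rangle\ge\sum_{i=0}^{\infty}p^i\widehat{\gamma}_i(\omega_a)\widehat{\gamma}_i(\omega_b)\ge\sum_{i=0}^{\infty}p^i\widetilde{\gamma}_i(\omega_a)\widetilde{\gamma}_i(\omega_b).$$
   Context: $p$ is a prime. $\mathcal{F}=(V,E)$ is an infinite directed rooted tree with root $\delta$ in which every vertex has exactly $p$ children. For $v\in V$, $N_v$ denotes the set of children of $v$. A real weight function with weight $\omega$ is a function $a:V\to\mathbb{R}_{\ge1}\cup\{0\}$ satisfying: 1. for every infinite path $T$ starting at $\delta$, $\sum_{v\in T}a(v)\ge\omega$; 2. for every $v$, $a(v)\ge\sum_{u\in N_v}a(u)$. It is called integral if it takes values in $\mathbb{Z}_{\ge0}$. The scalar product is $\langle a,b\rangle=\sum_{v\in V}a(v)b(v)$. A (real) resolution of $\omega$ is a sequence $(\gamma_i)_{i\ge0}$ in $\mathbb{R}_{\ge1}\cup\{0\}$ with $\gamma_i\ge p\gamma_{i+1}$ and $\sum_i\gamma_i=\omega$. The lexicographically minimal one is $\widetilde{\gamma}_i(\omega)$. Integral resolutions take values in $\mathbb{Z}_{\ge0}$, and the lexicographically minimal one is $\widehat{\gamma}_i(\omega)$. The lexicographic order compares sequences at the first differing index.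
   Formalization: The real resolutions of ω take values in ℚ rather than in $\mathbb{R}_{\ge1}\cup\{0\}$, and $\widetilde{\gamma}_i(\omega)$ is the lexicographically minimal one among these rational resolutions. -}

module Defs where

open import Data.Nat as ℕ using (ℕ; zero; suc; _^_)
open import Data.Fin using (Fin)
open import Data.List using (List; []; _∷_; map; concatMap; allFin)
open import Data.Nat.ListAction using (sum)
open import Data.Product using (Σ; ∃; _×_)
open import Data.Sum using (_⊎_)
open import Data.Integer using (+_)
open import Data.Rational as ℚ using (ℚ; 0ℚ; 1ℚ)
open import Relation.Binary.PropositionalEquality using (_≡_)

-- The rooted p-ary tree F.
-- A vertex is the list of child-choices from the root δ, most recent
-- choice first.  The root δ is [], the children of v are  i ∷ v.

Vertex : ℕ → Set
Vertex p = List (Fin p)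

root : ∀ {p} → Vertex p
root = []

childSum : ∀ {p} → (Vertex p → ℕ) → Vertex p → ℕ
childSum {p} a v = sum (map (λ i → a (i ∷ v)) (allFin p))

level : (p : ℕ) → ℕ → List (Vertex p)
level p zero    = [] ∷ []
level p (suc n) = concatMap (λ v → map (λ i → i ∷ v) (allFin p)) (level p n)

pathVertex : ∀ {p} → (ℕ → Fin p) → ℕ → Vertex p
pathVertex t zero    = []
pathVertex t (suc k) = t k ∷ pathVertex t k

psum : (ℕ → ℕ) → ℕ → ℕ
psum f zero    = 0
psum f (suc n) = psum f n ℕ.+ f n

psumℚ : (ℕ → ℚ) → ℕ → ℚ
psumℚ f zero    = 0ℚ
psumℚ f (suc n) = psumℚ f n ℚ.+ f n

-- Condition 1: along every infinite path from δ the (nonnegative,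
-- possibly infinite) sum is ≥ ω, i.e. some partial sum reaches ω.

record IsIntWeightFunction (p : ℕ) (ω : ℕ) (a : Vertex p → ℕ) : Set where
  field
    pathSum  : (t : ℕ → Fin p) → ∃ λ n → ω ℕ.≤ psum (λ k → a (pathVertex t k)) n
    children : (v : Vertex p) → childSum a v ℕ.≤ a v

-- partial scalar product: Σ over all vertices of depth < n of a(v) b(v).
-- ⟨a,b⟩ (a sum of nonnegative terms, possibly +∞) is the supremum of these.
scalarPartial : (p : ℕ) → (Vertex p → ℕ) → (Vertex p → ℕ) → ℕ → ℕ
scalarPartial p a b = psum (λ d → sum (map (λ v → a v ℕ.* b v) (level p d)))

-- Comparisons of (possibly infinite) sums of nonnegative terms, each
-- given by its sequence of partial sums:  sup S ≥ sup T.

SupGeq : (ℕ → ℕ) → (ℕ → ℕ) → Set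
SupGeq S T = ∀ n → ∃ λ m → T n ℕ.≤ S m

SupGeqℚ : (ℕ → ℕ) → (ℕ → ℚ) → Set
SupGeqℚ S T = ∀ n → ∃ λ m → T n ℚ.≤ (+ (S m) ℚ./ 1)

LexLt : {A : Set} → (A → A → Set) → (ℕ → A) → (ℕ → A) → Set
LexLt _<_ γ δ = ∃ λ i → ((j : ℕ) → j ℕ.< i → γ j ≡ δ j) × (γ i < δ i)

LexLeq : {A : Set} → (A → A → Set) → (ℕ → A) → (ℕ → A) → Set
LexLeq _<_ γ δ = ((i : ℕ) → γ i ≡ δ i) ⊎ LexLt _<_ γ δ

-- Integral resolutions of ω: γ_i ∈ ℤ≥0, γ_i ≥ p γ_{i+1}, Σ γ_i = ω
-- (a convergent series of naturals: partial sums eventually equal ω).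

record IsIntResolution (p ω : ℕ) (γ : ℕ → ℕ) : Set where
  field
    decreasing : ∀ i → p ℕ.* γ (suc i) ℕ.≤ γ i
    sumEq      : ∃ λ N → ∀ n → N ℕ.≤ n → psum γ n ≡ ω

record IsLexMinIntResolution (p ω : ℕ) (γ : ℕ → ℕ) : Set where
  field
    isRes : IsIntResolution p ω γ
    least : ∀ δ → IsIntResolution p ω δ → LexLeq ℕ._<_ γ δ

ℚofℕ : ℕ → ℚ
ℚofℕ n = + n ℚ./ 1

record IsRealResolution (p ω : ℕ) (γ : ℕ → ℚ) : Set where
  field
    values     : ∀ i → (γ i ≡ 0ℚ) ⊎ (1ℚ ℚ.≤ γ i)
    decreasing : ∀ i → ℚofℕ p ℚ.* γ (suc i) ℚ.≤ γ i
    sumEq      : ∀ ε → 0ℚ ℚ.< ε →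
                 ∃ λ N → ∀ n → N ℕ.≤ n → ℚ.∣ psumℚ γ n ℚ.- ℚofℕ ω ∣ ℚ.< ε

record IsLexMinRealResolution (p ω : ℕ) (γ : ℕ → ℚ) : Set where
  field
    isRes : IsRealResolution p ω γ
    least : ∀ δ → IsRealResolution p ω δ → LexLeq ℚ._<_ γ δ

-- The lexicographically minimal integral resolution is greedy: γ̂₀(ω) is the least x such that
-- x + ⌊x/p⌋ + ⌊x/p²⌋ + ⋯, the largest total of an integral sequence starting with x and shrinking
-- by a factor p at each step, reaches ω, and γ̂(ω) continues as γ̂(ω − γ̂₀(ω)).  Following, from the
-- root, a child whose weight is at most a p-th of its parent's (one exists by condition 2) produces
-- such a sequence, so condition 1 forces a(δ) ≥ γ̂₀(ω_a).  The p subtrees of δ carry weight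
-- functions of weight ω_a − a(δ), and the first inequality follows by induction on the depth: the
-- defect between a(δ)b(δ) and γ̂₀(ω_a)γ̂₀(ω_b) pays for the change of the remaining weights,
-- because γ̂ is monotone in ω and its partial sums grow by at most the increase of ω.
--
-- For the second inequality let repunit k = 1 + p + ⋯ + pᵏ and repunit k_a ≤ ω_a < repunit (k_a + 1),
-- and similarly for ω_b; both kinds of resolution of ω_a vanish beyond k_a.  With N = max(k_a, k_b),
-- Chebyshev's sum inequality for the antitone sequences pⁱγ̂ᵢ, weighted by p^(N−i), gives
-- Σ pⁱγ̂ᵢ(ω_a)γ̂ᵢ(ω_b) ≥ p^N ω_a ω_b / repunit N.  Comparing γ̃(ω) with the resolution proportional
-- to p^(k−i) bounds γ̃₀(ω), and with it every pⁱγ̃ᵢ(ω), by ω pᵏ / repunit k.  Summing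
-- p⁻ⁱ(pⁱγ̃ᵢ(ω_a))(pⁱγ̃ᵢ(ω_b)) over i ≤ M = min(k_a, k_b) then gives the same bound,
-- as {M, N} = {k_a, k_b}.

module Submission where

open import Algebra.Bundles using (CommutativeMonoid)
open import Data.Fin using (Fin)
open import Data.Fin.Properties using (any?)
import Data.Integer as ℤ
import Data.Integer.Properties as ZP
open import Data.List using (List; []; _∷_; map; allFin; _++_; length; concatMap)
open import Data.List.Properties using (map-++; map-cong; map-∘; length-tabulate)
open import Data.Nat as ℕ
  using (ℕ; zero; suc; _+_; _*_; _∸_; _^_; _/_; _≤_; _<_; _⊓_; _⊔_; z≤n; s≤s; NonZero; NonTrivial;
         nonTrivial⇒n>1; nonTrivial⇒nonZero)
import Data.Nat.Coprimality as C
open import Data.Nat.DivMod using (0/n≡0; m/n<m; m/n≤m; /-monoˡ-≤; m*n/n≡m; m/n*n≤m)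
open import Data.Nat.Induction using (<-rec)
open import Data.Nat.ListAction using (sum)
open import Data.Nat.ListAction.Properties using (sum-++)
open import Data.Nat.Primality using (Prime; prime⇒nonTrivial)
open import Data.Nat.Properties
open import Data.Nat.Tactic.RingSolver using (solve-∀)
open import Data.Product using (∃; _×_; _,_; proj₁; proj₂)
import Data.Rational as ℚ
import Data.Rational.Properties as RP
open import Data.Rational.Solver using (module +-*-Solver)
open import Data.Sum using (_⊎_; inj₁; inj₂)
open import Function using (_∘_; id)
open import Relation.Binary.Definitions using (Irreflexive; Asymmetric; tri<; tri≈; tri>)
open import Relation.Binary.PropositionalEquality
open import Relation.Nullary using (yes; no; contradiction)

open import Algebra.Properties.CommutativeSemigroup *-commutativeSemigroup using (x∙yz≈y∙xz)
import Algebra.Properties.CommutativeSemigroup (CommutativeMonoid.commutativeSemigroup RP.*-1-commutativeMonoid) as ℚ*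

open import Defs

open ℚ using (0ℚ; 1ℚ; 1/_)

product-exchange : ∀ P {x X y Y} G H → x ≤ X → y ≤ Y → P * Y ≤ G → P * X ≤ H →
                   P * (X * Y) ≤ P * (x * y) + G * (X ∸ x) + H * (Y ∸ y)
product-exchange P {x} {y = y} G H x≤X y≤Y PY≤G PX≤H with m≤n⇒∃[o]m+o≡n x≤X | m≤n⇒∃[o]m+o≡n y≤Y
... | s , refl | t , refl rewrite m+n∸m≡n x s | m+n∸m≡n y t = begin
  P * ((x + s) * (y + t))                     ≡⟨ expand P x s y t ⟩
  P * (x * y) + s * (P * (y + t)) + P * x * t
    ≤⟨ +-mono-≤ (+-monoʳ-≤ (P * (x * y)) (*-monoʳ-≤ s PY≤G)) (*-monoˡ-≤ t (≤-trans (*-monoʳ-≤ P (m≤m+n x s)) PX≤H)) ⟩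
  P * (x * y) + s * G + H * t                 ≡⟨ cong (λ z → P * (x * y) + z + H * t) (*-comm s G) ⟩
  P * (x * y) + G * s + H * t                 ∎
  where
  open ≤-Reasoning
  expand : ∀ P x s y t → P * ((x + s) * (y + t)) ≡ P * (x * y) + s * (P * (y + t)) + P * x * t
  expand = solve-∀

mixed-terms≤product : ∀ {g x h y} → g ≤ x → h ≤ y → g * h + h * (x ∸ g) + g * (y ∸ h) ≤ x * y
mixed-terms≤product {g} {h = h} g≤x h≤y with m≤n⇒∃[o]m+o≡n g≤x | m≤n⇒∃[o]m+o≡n h≤y
... | s , refl | t , refl rewrite m+n∸m≡n g s | m+n∸m≡n h t = begin
  g * h + h * s + g * t          ≤⟨ m≤m+n _ (s * t) ⟩
  g * h + h * s + g * t + s * t  ≡⟨ expand g h s t ⟩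
  (g + s) * (h + t)              ∎
  where
  open ≤-Reasoning
  expand : ∀ g h s t → g * h + h * s + g * t + s * t ≡ (g + s) * (h + t)
  expand = solve-∀

∸-∸-≤ : ∀ m {g x} → g ≤ x → (m ∸ g) ∸ (m ∸ x) ≤ x ∸ g
∸-∸-≤ m {g} {x} g≤x = m≤n+o⇒m∸n≤o (m ∸ g) (m ∸ x) (begin
  m ∸ g                    ≤⟨ ∸-monoˡ-≤ g (m≤n+m∸n m x) ⟩
  x + (m ∸ x) ∸ g          ≡⟨ +-∸-comm (m ∸ x) g≤x ⟩
  x ∸ g + (m ∸ x)          ≡⟨ +-comm (x ∸ g) (m ∸ x) ⟩
  m ∸ x + (x ∸ g)          ∎)
  where open ≤-Reasoning

root-exchange : ∀ P {g h x y u v s t} F → g ≤ x → h ≤ y → P * u ≤ h → P * v ≤ g →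
                s ≤ x ∸ g → t ≤ y ∸ h → g * h + P * (F + u * s + v * t) ≤ x * y + P * F
root-exchange P {g} {h} {x} {y} {u} {v} {s} {t} F g≤x h≤y Pu≤h Pv≤g s≤ t≤ = begin
  g * h + P * (F + u * s + v * t)           ≡⟨ rearrange g h P F u s v t ⟩
  g * h + P * u * s + P * v * t + P * F
    ≤⟨ +-monoˡ-≤ (P * F) (+-mono-≤ (+-monoʳ-≤ (g * h) (*-mono-≤ Pu≤h s≤)) (*-mono-≤ Pv≤g t≤)) ⟩
  g * h + h * (x ∸ g) + g * (y ∸ h) + P * F ≤⟨ +-monoˡ-≤ (P * F) (mixed-terms≤product g≤x h≤y) ⟩
  x * y + P * F                             ∎
  where
  open ≤-Reasoning
  rearrange : ∀ g h P F u s v t → g * h + P * (F + u * s + v * t) ≡ g * h + P * u * s + P * v * t + P * F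
  rearrange = solve-∀

rearrangement : ∀ {X x Y y} → X ≤ x → Y ≤ y → X * y + Y * x ≤ x * y + X * Y
rearrangement {X} {Y = Y} X≤x Y≤y with m≤n⇒∃[o]m+o≡n X≤x | m≤n⇒∃[o]m+o≡n Y≤y
... | s , refl | t , refl = begin
  X * (Y + t) + Y * (X + s)          ≤⟨ m≤m+n _ (s * t) ⟩
  X * (Y + t) + Y * (X + s) + s * t  ≡⟨ expand X Y s t ⟩
  (X + s) * (Y + t) + X * Y          ∎
  where
  open ≤-Reasoning
  expand : ∀ X Y s t → X * (Y + t) + Y * (X + s) + s * t ≡ (X + s) * (Y + t) + X * Y
  expand = solve-∀

⊓-⊔-* : ∀ (f : ℕ → ℕ) m n → f (m ⊓ n) * f (m ⊔ n) ≡ f m * f n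
⊓-⊔-* f m n with ≤-total m n
... | inj₁ m≤n = cong₂ (λ a b → f a * f b) (m≤n⇒m⊓n≡m m≤n) (m≤n⇒m⊔n≡n m≤n)
... | inj₂ n≤m = trans (cong₂ (λ a b → f a * f b) (m≥n⇒m⊓n≡n n≤m) (m≥n⇒m⊔n≡m n≤m)) (*-comm (f n) (f m))

-- Partial sums and Chebyshev's sum inequality

psum-cons : ∀ f n → psum f (suc n) ≡ f 0 + psum (f ∘ suc) n
psum-cons f zero    = +-comm 0 (f 0)
psum-cons f (suc n) = trans (cong (_+ f (suc n)) (psum-cons f n)) (+-assoc (f 0) _ _)

psum-cong : ∀ {f g} n → (∀ i → i < n → f i ≡ g i) → psum f n ≡ psum g n
psum-cong zero    f≡g = refl
psum-cong (suc n) f≡g = cong₂ _+_ (psum-cong n (λ i i<n → f≡g i (m<n⇒m<1+n i<n))) (f≡g n ≤-refl)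

psum-mono-≤ : ∀ {f g} n → (∀ i → i < n → f i ≤ g i) → psum f n ≤ psum g n
psum-mono-≤ zero    f≤g = z≤n
psum-mono-≤ (suc n) f≤g = +-mono-≤ (psum-mono-≤ n (λ i i<n → f≤g i (m<n⇒m<1+n i<n))) (f≤g n ≤-refl)

psum-+ : ∀ f g n → psum (λ i → f i + g i) n ≡ psum f n + psum g n
psum-+ f g zero    = refl
psum-+ f g (suc n) = trans (cong (_+ (f n + g n)) (psum-+ f g n)) (interchange (psum f n) (psum g n) (f n) (g n))
  where
  interchange : ∀ a b c d → a + b + (c + d) ≡ a + c + (b + d)
  interchange = solve-∀

psum-*ˡ : ∀ c f n → psum (λ i → c * f i) n ≡ c * psum f n
psum-*ˡ c f zero    = sym (*-zeroʳ c)
psum-*ˡ c f (suc n) = trans (cong (_+ c * f n) (psum-*ˡ c f n)) (sym (*-distribˡ-+ c (psum f n) (f n)))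

psum-*ʳ : ∀ c f n → psum (λ i → f i * c) n ≡ psum f n * c
psum-*ʳ c f n = trans (psum-cong n (λ i _ → *-comm (f i) c)) (trans (psum-*ˡ c f n) (*-comm c (psum f n)))

psum-monoʳ-≤ : ∀ f {m n} → m ≤ n → psum f m ≤ psum f n
psum-monoʳ-≤ f {n = zero}  z≤n = z≤n
psum-monoʳ-≤ f {m} {suc n} m≤1+n with m≤n⇒m<n∨m≡n m≤1+n
... | inj₁ m<1+n = ≤-trans (psum-monoʳ-≤ f (≤-pred m<1+n)) (m≤m+n (psum f n) (f n))
... | inj₂ refl  = ≤-refl

psum-term : ∀ f {i n} → i < n → f i ≤ psum f n
psum-term f {i} {suc n} i<1+n with m≤n⇒m<n∨m≡n (≤-pred i<1+n)
... | inj₁ i<n = ≤-trans (psum-term f i<n) (m≤m+n (psum f n) (f n))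
... | inj₂ refl = m≤n+m (f i) (psum f i)

psum-stable : ∀ f {m n} → (∀ i → m ≤ i → f i ≡ 0) → m ≤ n → psum f n ≡ psum f m
psum-stable f {m} {zero} f≡0 z≤n = refl
psum-stable f {m} {suc n} f≡0 m≤1+n with m≤n⇒m<n∨m≡n m≤1+n
... | inj₁ m<1+n =
  trans (cong₂ _+_ (psum-stable f f≡0 (≤-pred m<1+n)) (f≡0 n (≤-pred m<1+n))) (+-identityʳ (psum f m))
... | inj₂ refl  = refl

module _ {A : Set} where

  sum-map-*ˡ : ∀ c (f : A → ℕ) xs → sum (map (λ x → c * f x) xs) ≡ c * sum (map f xs)
  sum-map-*ˡ c f []       = sym (*-zeroʳ c)
  sum-map-*ˡ c f (x ∷ xs) = trans (cong (c * f x +_) (sum-map-*ˡ c f xs)) (sym (*-distribˡ-+ c (f x) _))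

  sum-map-≥ : ∀ (f : A → ℕ) {c} xs → (∀ x → c ≤ f x) → length xs * c ≤ sum (map f xs)
  sum-map-≥ f []       c≤f = z≤n
  sum-map-≥ f (x ∷ xs) c≤f = +-mono-≤ (c≤f x) (sum-map-≥ f xs c≤f)

  sum-map-concatMap : ∀ {B : Set} (h : B → ℕ) (g : A → List B) xs →
                      sum (map h (concatMap g xs)) ≡ sum (map (λ x → sum (map h (g x))) xs)
  sum-map-concatMap h g []       = refl
  sum-map-concatMap h g (x ∷ xs) = begin
    sum (map h (g x ++ concatMap g xs))                ≡⟨ cong sum (map-++ h (g x) (concatMap g xs)) ⟩
    sum (map h (g x) ++ map h (concatMap g xs))        ≡⟨ sum-++ (map h (g x)) _ ⟩
    sum (map h (g x)) + sum (map h (concatMap g xs))   ≡⟨ cong (sum (map h (g x)) +_) (sum-map-concatMap h g xs) ⟩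
    sum (map h (g x)) + sum (map (λ y → sum (map h (g y))) xs) ∎
    where open ≡-Reasoning

  psum-sum-map : ∀ (F : A → ℕ → ℕ) xs n →
                 psum (λ d → sum (map (λ x → F x d) xs)) n ≡ sum (map (λ x → psum (F x) n) xs)
  psum-sum-map F []       n = psum-stable (λ _ → 0) {n = n} (λ _ _ → refl) z≤n
  psum-sum-map F (x ∷ xs) n = trans (psum-+ (F x) _ n) (cong (psum (F x) n +_) (psum-sum-map F xs n))

module _ (u x y : ℕ → ℕ) where

  chebyshev-step : ∀ {X Y} n → (∀ i → i < n → X ≤ x i) → (∀ i → i < n → Y ≤ y i) →
    X * psum (λ i → u i * y i) n + Y * psum (λ i → u i * x i) n ≤
    psum (λ i → u i * (x i * y i)) n + psum u n * (X * Y)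
  chebyshev-step {X} {Y} zero    _   _   = ≤-reflexive (vanish X Y)
    where
    vanish : ∀ X Y → X * 0 + Y * 0 ≡ 0 + 0 * (X * Y)
    vanish = solve-∀
  chebyshev-step {X} {Y} (suc n) X≤x Y≤y = begin
    X * (Σuy + u n * y n) + Y * (Σux + u n * x n)         ≡⟨ split X Y Σuy Σux (u n) (y n) (x n) ⟩
    (X * Σuy + Y * Σux) + u n * (X * y n + Y * x n)
      ≤⟨ +-mono-≤ (chebyshev-step n (λ i i<n → X≤x i (m<n⇒m<1+n i<n)) (λ i i<n → Y≤y i (m<n⇒m<1+n i<n)))
                  (*-monoʳ-≤ (u n) (rearrangement (X≤x n ≤-refl) (Y≤y n ≤-refl))) ⟩
    (Σuxy + Σu * (X * Y)) + u n * (x n * y n + X * Y)     ≡⟨ merge Σuxy Σu X Y (u n) (x n) (y n) ⟩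
    (Σuxy + u n * (x n * y n)) + (Σu + u n) * (X * Y)     ∎
    where
    open ≤-Reasoning
    Σux = psum (λ i → u i * x i) n
    Σuy = psum (λ i → u i * y i) n
    Σuxy = psum (λ i → u i * (x i * y i)) n
    Σu = psum u n
    split : ∀ X Y a b w s t → X * (a + w * s) + Y * (b + w * t) ≡ (X * a + Y * b) + w * (X * s + Y * t)
    split = solve-∀
    merge : ∀ P U X Y w s t → (P + U * (X * Y)) + w * (s * t + X * Y) ≡ (P + w * (s * t)) + (U + w) * (X * Y)
    merge = solve-∀

  chebyshev : (∀ {i j} → i ≤ j → x j ≤ x i) → (∀ {i j} → i ≤ j → y j ≤ y i) → ∀ n →
    psum (λ i → u i * x i) n * psum (λ i → u i * y i) n ≤ psum u n * psum (λ i → u i * (x i * y i)) n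
  chebyshev x↓ y↓ zero    = z≤n
  chebyshev x↓ y↓ (suc n) = begin
    (Σux + u n * x n) * (Σuy + u n * y n)                          ≡⟨ split Σux Σuy (u n) (x n) (y n) ⟩
    Σux * Σuy + u n * (x n * Σuy + y n * Σux) + u n * u n * (x n * y n)
      ≤⟨ +-monoˡ-≤ (u n * u n * (x n * y n)) (+-mono-≤ (chebyshev x↓ y↓ n)
           (*-monoʳ-≤ (u n) (chebyshev-step n (λ i i<n → x↓ (<⇒≤ i<n)) (λ i i<n → y↓ (<⇒≤ i<n))))) ⟩
    Σu * Σuxy + u n * (Σuxy + Σu * (x n * y n)) + u n * u n * (x n * y n) ≡⟨ merge Σu Σuxy (u n) (x n) (y n) ⟩
    (Σu + u n) * (Σuxy + u n * (x n * y n))                        ∎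
    where
    open ≤-Reasoning
    Σux = psum (λ i → u i * x i) n
    Σuy = psum (λ i → u i * y i) n
    Σuxy = psum (λ i → u i * (x i * y i)) n
    Σu = psum u n
    split : ∀ a b w s t → (a + w * s) * (b + w * t) ≡ a * b + w * (s * b + t * a) + w * w * (s * t)
    split = solve-∀
    merge : ∀ U P w s t → U * P + w * (P + U * (s * t)) + w * w * (s * t) ≡ (U + w) * (P + w * (s * t))
    merge = solve-∀

-- Lexicographically minimal integral resolutions

module _ {A : Set} {_≺_ : A → A → Set} where

  lexLeq-cons : ∀ {γ δ : ℕ → A} → γ 0 ≡ δ 0 → LexLeq _≺_ (γ ∘ suc) (δ ∘ suc) → LexLeq _≺_ γ δ
  lexLeq-cons γ₀≡δ₀ (inj₁ γ≡δ) = inj₁ λ { zero → γ₀≡δ₀ ; (suc i) → γ≡δ i }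
  lexLeq-cons γ₀≡δ₀ (inj₂ (i , agree , γᵢ≺δᵢ)) =
    inj₂ (suc i , (λ { zero _ → γ₀≡δ₀ ; (suc j) j<1+i → agree j (≤-pred j<1+i) }) , γᵢ≺δᵢ)

  lexLeq-antisym : Irreflexive _≡_ _≺_ → Asymmetric _≺_ →
                   ∀ {γ δ} → LexLeq _≺_ γ δ → LexLeq _≺_ δ γ → ∀ i → γ i ≡ δ i
  lexLeq-antisym _ _ (inj₁ γ≡δ) _          = γ≡δ
  lexLeq-antisym _ _ (inj₂ _)   (inj₁ δ≡γ) = sym ∘ δ≡γ
  lexLeq-antisym irrefl asym (inj₂ (i , γ≡δ<i , γᵢ≺δᵢ)) (inj₂ (j , δ≡γ<j , δⱼ≺γⱼ)) with <-cmp i j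
  ... | tri< i<j _ _ = contradiction γᵢ≺δᵢ (irrefl (sym (δ≡γ<j i i<j)))
  ... | tri≈ _ refl _ = contradiction δⱼ≺γⱼ (asym γᵢ≺δᵢ)
  ... | tri> _ _ j<i = contradiction δⱼ≺γⱼ (irrefl (sym (γ≡δ<i j j<i)))

module _ (p : ℕ) where

  Descending : (ℕ → ℕ) → Set
  Descending δ = ∀ i → p * δ (suc i) ≤ δ i

  descending-pow : ∀ {δ} → Descending δ → ∀ j d → p ^ d * δ (j + d) ≤ δ j
  descending-pow {δ} δ↓ j zero    = ≤-reflexive (trans (*-identityˡ _) (cong δ (+-identityʳ j)))
  descending-pow {δ} δ↓ j (suc d) = begin
    p * p ^ d * δ (j + suc d)   ≡⟨ *-assoc p (p ^ d) _ ⟩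
    p * (p ^ d * δ (j + suc d)) ≡⟨ cong (λ k → p * (p ^ d * δ k)) (+-suc j d) ⟩
    p * (p ^ d * δ (suc j + d)) ≤⟨ *-monoʳ-≤ p (descending-pow δ↓ (suc j) d) ⟩
    p * δ (suc j)               ≤⟨ δ↓ j ⟩
    δ j                         ∎
    where open ≤-Reasoning

  module _ {ω : ℕ} {δ : ℕ → ℕ} (res : IsIntResolution p ω δ) where
    open IsIntResolution res

    resolution-psum≤ : ∀ n → psum δ n ≤ ω
    resolution-psum≤ n with sumEq
    ... | N , total = begin
      psum δ n       ≤⟨ psum-monoʳ-≤ δ (m≤n⊔m N n) ⟩
      psum δ (N ⊔ n) ≡⟨ total (N ⊔ n) (m≤m⊔n N n) ⟩
      ω              ∎
      where open ≤-Reasoning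

    resolution-psum-vanishing : ∀ n → (∀ i → n ≤ i → δ i ≡ 0) → psum δ n ≡ ω
    resolution-psum-vanishing n δ≡0 with sumEq
    ... | N , total = trans (sym (psum-stable δ δ≡0 (m≤n⊔m N n))) (total (N ⊔ n) (m≤m⊔n N n))

    resolution-tail : IsIntResolution p (ω ∸ δ 0) (δ ∘ suc)
    resolution-tail = record { decreasing = decreasing ∘ suc ; sumEq = tailSum }
      where
      tailSum : ∃ λ N → ∀ n → N ≤ n → psum (δ ∘ suc) n ≡ ω ∸ δ 0
      tailSum with sumEq
      ... | N , total = N , λ n N≤n → begin
        psum (δ ∘ suc) n               ≡⟨ m+n∸m≡n (δ 0) _ ⟨
        δ 0 + psum (δ ∘ suc) n ∸ δ 0   ≡⟨ cong (_∸ δ 0) (psum-cons δ n) ⟨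
        psum δ (suc n) ∸ δ 0           ≡⟨ cong (_∸ δ 0) (total (suc n) (m≤n⇒m≤1+n N≤n)) ⟩
        ω ∸ δ 0                        ∎
        where open ≡-Reasoning

  resolution-of-0 : ∀ {δ} → IsIntResolution p 0 δ → ∀ i → δ i ≡ 0
  resolution-of-0 {δ} res i = n≤0⇒n≡0 (≤-trans (psum-term δ ≤-refl) (resolution-psum≤ res (suc i)))

  descending-scaled-antitone : ∀ {γ} → Descending γ → ∀ {i j} → i ≤ j → p ^ j * γ j ≤ p ^ i * γ i
  descending-scaled-antitone {γ} γ↓ {i} i≤j with m≤n⇒∃[o]m+o≡n i≤j
  ... | d , refl = begin
    p ^ (i + d) * γ (i + d)     ≡⟨ cong (_* γ (i + d)) (^-distribˡ-+-* p i d) ⟩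
    p ^ i * p ^ d * γ (i + d)   ≡⟨ *-assoc (p ^ i) (p ^ d) _ ⟩
    p ^ i * (p ^ d * γ (i + d)) ≤⟨ *-monoʳ-≤ (p ^ i) (descending-pow γ↓ i d) ⟩
    p ^ i * γ i                 ∎
    where open ≤-Reasoning

module LexMinIntResolution (p : ℕ) (1<p : 1 < p) where
  instance
    p≢0 : NonZero p
    p≢0 = ℕ.>-nonZero (<-trans ℕ.z<s 1<p)

  -- x + ⌊x/p⌋ + ⌊x/p²⌋ + ⋯, computed with fuel; any fuel exceeding x gives the full sum
  maxTotalWithin : ℕ → ℕ → ℕ
  maxTotalWithin zero    x = 0
  maxTotalWithin (suc k) x = x + maxTotalWithin k (x / p)

  maxTotal : ℕ → ℕ
  maxTotal x = maxTotalWithin (suc x) x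

  maxTotalWithin-0 : ∀ k → maxTotalWithin k 0 ≡ 0
  maxTotalWithin-0 zero    = refl
  maxTotalWithin-0 (suc k) = trans (cong (maxTotalWithin k) (0/n≡0 p)) (maxTotalWithin-0 k)

  maxTotalWithin-fuel : ∀ k l x → x < k → x < l → maxTotalWithin k x ≡ maxTotalWithin l x
  maxTotalWithin-fuel (suc k) (suc l) zero    _ _ = trans (maxTotalWithin-0 (suc k)) (sym (maxTotalWithin-0 (suc l)))
  maxTotalWithin-fuel (suc k) (suc l) (suc x) x<k x<l =
    cong (suc x +_) (maxTotalWithin-fuel k l (suc x / p) (<-≤-trans x/p<x (≤-pred x<k))
                                                         (<-≤-trans x/p<x (≤-pred x<l)))
    where
    x/p<x : suc x / p < suc x
    x/p<x = m/n<m (suc x) p 1<p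

  maxTotal-unfold : ∀ x → maxTotal x ≡ x + maxTotal (x / p)
  maxTotal-unfold zero    = cong maxTotal (sym (0/n≡0 p))
  maxTotal-unfold (suc x) =
    cong (suc x +_) (maxTotalWithin-fuel (suc x) (suc (suc x / p)) (suc x / p) (m/n<m (suc x) p 1<p) ≤-refl)

  maxTotalWithin-mono : ∀ k {x y} → x ≤ y → maxTotalWithin k x ≤ maxTotalWithin k y
  maxTotalWithin-mono zero    x≤y = z≤n
  maxTotalWithin-mono (suc k) x≤y = +-mono-≤ x≤y (maxTotalWithin-mono k (/-monoˡ-≤ p x≤y))

  maxTotal-mono : ∀ {x y} → x ≤ y → maxTotal x ≤ maxTotal y
  maxTotal-mono {x} {y} x≤y = begin
    maxTotalWithin (suc x) x ≡⟨ maxTotalWithin-fuel (suc x) (suc y) x ≤-refl (s≤s x≤y) ⟩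
    maxTotalWithin (suc y) x ≤⟨ maxTotalWithin-mono (suc y) x≤y ⟩
    maxTotalWithin (suc y) y ∎
    where open ≤-Reasoning

  maxTotal-suc : ∀ x → maxTotal x < maxTotal (suc x)
  maxTotal-suc x = begin-strict
    maxTotal x              ≡⟨ maxTotal-unfold x ⟩
    x + maxTotal (x / p)    <⟨ +-monoʳ-≤ (suc x) (maxTotal-mono (/-monoˡ-≤ p (n≤1+n x))) ⟩
    suc x + maxTotal (suc x / p) ≡⟨ maxTotal-unfold (suc x) ⟨
    maxTotal (suc x)        ∎
    where open ≤-Reasoning

  ≤⇒≤/p : ∀ {y x} → p * y ≤ x → y ≤ x / p
  ≤⇒≤/p {y} {x} py≤x = subst (_≤ x / p) (m*n/n≡m y p) (/-monoˡ-≤ p (subst (_≤ x) (*-comm p y) py≤x))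

  descending-psum≤maxTotal : ∀ {δ} → Descending p δ → ∀ n → psum δ n ≤ maxTotal (δ 0)
  descending-psum≤maxTotal δ↓ zero    = z≤n
  descending-psum≤maxTotal {δ} δ↓ (suc n) = begin
    psum δ (suc n)                ≡⟨ psum-cons δ n ⟩
    δ 0 + psum (δ ∘ suc) n        ≤⟨ +-monoʳ-≤ (δ 0) (descending-psum≤maxTotal (δ↓ ∘ suc) n) ⟩
    δ 0 + maxTotal (δ 1)          ≤⟨ +-monoʳ-≤ (δ 0) (maxTotal-mono (≤⇒≤/p (δ↓ 0))) ⟩
    δ 0 + maxTotal (δ 0 / p)      ≡⟨ maxTotal-unfold (δ 0) ⟨
    maxTotal (δ 0)                ∎
    where open ≤-Reasoning

  x≤maxTotal : ∀ x → x ≤ maxTotal x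
  x≤maxTotal x = m≤m+n x _

  γ̂₀ : ℕ → ℕ
  γ̂₀ zero    = 0
  γ̂₀ (suc ω) with suc ω ≤? maxTotal (γ̂₀ ω)
  ... | yes _ = γ̂₀ ω
  ... | no  _ = suc (γ̂₀ ω)

  γ̂₀-sufficient : ∀ ω → ω ≤ maxTotal (γ̂₀ ω)
  γ̂₀-sufficient zero = z≤n
  γ̂₀-sufficient (suc ω) with suc ω ≤? maxTotal (γ̂₀ ω)
  ... | yes ω<total = ω<total
  ... | no  _       = <-≤-trans (s≤s (γ̂₀-sufficient ω)) (maxTotal-suc (γ̂₀ ω))

  γ̂₀-least : ∀ ω {x} → ω ≤ maxTotal x → γ̂₀ ω ≤ x
  γ̂₀-least zero    _ = z≤n
  γ̂₀-least (suc ω) {x} ω<total with suc ω ≤? maxTotal (γ̂₀ ω)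
  ... | yes _ = γ̂₀-least ω (<⇒≤ ω<total)
  ... | no  ω≮total with m≤n⇒m<n∨m≡n (γ̂₀-least ω (<⇒≤ ω<total))
  ...   | inj₁ γ̂₀ω<x = γ̂₀ω<x
  ...   | inj₂ refl   = contradiction ω<total ω≮total

  γ̂₀-mono : ∀ {ω ω'} → ω ≤ ω' → γ̂₀ ω ≤ γ̂₀ ω'
  γ̂₀-mono {ω} {ω'} ω≤ω' = γ̂₀-least ω (≤-trans ω≤ω' (γ̂₀-sufficient ω'))

  γ̂₀-suc : ∀ ω → γ̂₀ (suc ω) ≤ suc (γ̂₀ ω)
  γ̂₀-suc ω = γ̂₀-least (suc ω) (<-≤-trans (s≤s (γ̂₀-sufficient ω)) (maxTotal-suc (γ̂₀ ω)))

  γ̂₀ω≤ω : ∀ ω → γ̂₀ ω ≤ ω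
  γ̂₀ω≤ω ω = γ̂₀-least ω (x≤maxTotal ω)

  γ̂₀-pos : ∀ ω → 0 < ω → 0 < γ̂₀ ω
  γ̂₀-pos ω 0<ω with γ̂₀ ω | γ̂₀-sufficient ω
  ... | zero  | ω≤0 = contradiction (<-≤-trans 0<ω ω≤0) (<-irrefl refl)
  ... | suc _ | _   = ℕ.z<s

  γ̂₀-remainder : ∀ ω → p * γ̂₀ (ω ∸ γ̂₀ ω) ≤ γ̂₀ ω
  γ̂₀-remainder ω = begin
    p * γ̂₀ (ω ∸ γ̂₀ ω)   ≤⟨ *-monoʳ-≤ p (γ̂₀-least (ω ∸ γ̂₀ ω) remainder≤) ⟩
    p * (γ̂₀ ω / p)      ≡⟨ *-comm p _ ⟩
    γ̂₀ ω / p * p        ≤⟨ m/n*n≤m (γ̂₀ ω) p ⟩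
    γ̂₀ ω                ∎
    where
    open ≤-Reasoning
    remainder≤ : ω ∸ γ̂₀ ω ≤ maxTotal (γ̂₀ ω / p)
    remainder≤ = begin
      ω ∸ γ̂₀ ω                                 ≤⟨ ∸-monoˡ-≤ (γ̂₀ ω) (γ̂₀-sufficient ω) ⟩
      maxTotal (γ̂₀ ω) ∸ γ̂₀ ω                   ≡⟨ cong (_∸ γ̂₀ ω) (maxTotal-unfold (γ̂₀ ω)) ⟩
      γ̂₀ ω + maxTotal (γ̂₀ ω / p) ∸ γ̂₀ ω        ≡⟨ m+n∸m≡n (γ̂₀ ω) _ ⟩
      maxTotal (γ̂₀ ω / p)                      ∎

  remainder-mono : ∀ {ω ω'} → ω ≤ ω' → ω ∸ γ̂₀ ω ≤ ω' ∸ γ̂₀ ω'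
  remainder-mono {ω' = zero}   z≤n  = ≤-refl
  remainder-mono {ω' = suc ω'} ω≤1+ω' with m≤n⇒m<n∨m≡n ω≤1+ω'
  ... | inj₁ ω<1+ω' = ≤-trans (remainder-mono (≤-pred ω<1+ω')) (∸-monoʳ-≤ (suc ω') (γ̂₀-suc ω'))
  ... | inj₂ refl   = ≤-refl

  γ̂ : ℕ → ℕ → ℕ
  γ̂ ω zero    = γ̂₀ ω
  γ̂ ω (suc i) = γ̂ (ω ∸ γ̂₀ ω) i

  γ̂-descending : ∀ ω → Descending p (γ̂ ω)
  γ̂-descending ω zero    = γ̂₀-remainder ω
  γ̂-descending ω (suc i) = γ̂-descending (ω ∸ γ̂₀ ω) i

  γ̂-mono : ∀ i {ω ω'} → ω ≤ ω' → γ̂ ω i ≤ γ̂ ω' i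
  γ̂-mono zero    ω≤ω' = γ̂₀-mono ω≤ω'
  γ̂-mono (suc i) ω≤ω' = γ̂-mono i (remainder-mono ω≤ω')

  γ̂-0 : ∀ i → γ̂ 0 i ≡ 0
  γ̂-0 zero    = refl
  γ̂-0 (suc i) = γ̂-0 i

  γ̂-psum : ∀ ω n → ω ≤ n → psum (γ̂ ω) n ≡ ω
  γ̂-psum zero    n       _         = psum-stable (γ̂ 0) {n = n} (λ i _ → γ̂-0 i) z≤n
  γ̂-psum (suc ω) (suc n) (s≤s ω≤n) = begin
    psum (γ̂ (suc ω)) (suc n)                        ≡⟨ psum-cons (γ̂ (suc ω)) n ⟩
    γ̂₀ (suc ω) + psum (γ̂ (suc ω ∸ γ̂₀ (suc ω))) n    ≡⟨ cong (γ̂₀ (suc ω) +_) (γ̂-psum _ n remainder≤n) ⟩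
    γ̂₀ (suc ω) + (suc ω ∸ γ̂₀ (suc ω))               ≡⟨ m+[n∸m]≡n (γ̂₀ω≤ω (suc ω)) ⟩
    suc ω                                           ∎
    where
    open ≡-Reasoning
    remainder≤n : suc ω ∸ γ̂₀ (suc ω) ≤ n
    remainder≤n = ≤-trans (∸-monoʳ-≤ (suc ω) (γ̂₀-pos (suc ω) ℕ.z<s)) ω≤n

  γ̂-isIntResolution : ∀ ω → IsIntResolution p ω (γ̂ ω)
  γ̂-isIntResolution ω = record { decreasing = γ̂-descending ω ; sumEq = ω , γ̂-psum ω }

  resolution-head : ∀ {ω δ} → IsIntResolution p ω δ → γ̂₀ ω ≤ δ 0
  resolution-head {ω} {δ} res with IsIntResolution.sumEq res
  ... | N , total = γ̂₀-least ω (begin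
    ω              ≡⟨ total N ≤-refl ⟨
    psum δ N       ≤⟨ descending-psum≤maxTotal (IsIntResolution.decreasing res) N ⟩
    maxTotal (δ 0) ∎)
    where open ≤-Reasoning

  γ̂-lexLeq : ∀ ω {δ} → IsIntResolution p ω δ → LexLeq _<_ (γ̂ ω) δ
  γ̂-lexLeq = <-rec (λ ω → ∀ {δ} → IsIntResolution p ω δ → LexLeq _<_ (γ̂ ω) δ) step
    where
    step : ∀ ω → (∀ {ω'} → ω' < ω → ∀ {δ} → IsIntResolution p ω' δ → LexLeq _<_ (γ̂ ω') δ) →
           ∀ {δ} → IsIntResolution p ω δ → LexLeq _<_ (γ̂ ω) δ
    step zero    _   res = inj₁ (λ i → trans (γ̂-0 i) (sym (resolution-of-0 p res i)))
    step (suc ω) rec {δ} res with m≤n⇒m<n∨m≡n (resolution-head res)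
    ... | inj₁ γ̂₀<δ₀ = inj₂ (0 , (λ _ ()) , γ̂₀<δ₀)
    ... | inj₂ γ̂₀≡δ₀ = lexLeq-cons {_≺_ = _<_} γ̂₀≡δ₀ (rec remainder<ω tail)
      where
      remainder<ω : suc ω ∸ γ̂₀ (suc ω) < suc ω
      remainder<ω = ∸-monoʳ-< {suc ω} (γ̂₀-pos (suc ω) ℕ.z<s) (γ̂₀ω≤ω (suc ω))
      tail : IsIntResolution p (suc ω ∸ γ̂₀ (suc ω)) (δ ∘ suc)
      tail = subst (λ x → IsIntResolution p (suc ω ∸ x) (δ ∘ suc)) (sym γ̂₀≡δ₀) (resolution-tail p res)

  lexMin⇒≡γ̂ : ∀ {ω γ} → IsLexMinIntResolution p ω γ → ∀ i → γ i ≡ γ̂ ω i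
  lexMin⇒≡γ̂ {ω} lexMin = lexLeq-antisym <-irrefl <-asym
    (IsLexMinIntResolution.least lexMin (γ̂ ω) (γ̂-isIntResolution ω))
    (γ̂-lexLeq ω (IsLexMinIntResolution.isRes lexMin))

-- Sums over the p-ary tree

module _ (p : ℕ) where

  -- vertices list the most recent choice first, so the subtree below the root's child i is v ↦ v ++ [i]
  subtree : (Vertex p → ℕ) → Fin p → Vertex p → ℕ
  subtree h i v = h (v ++ i ∷ [])

  levelSum : (Vertex p → ℕ) → ℕ → ℕ
  levelSum h d = sum (map h (level p d))

  levelSum-suc : ∀ h d → levelSum h (suc d) ≡ levelSum (childSum h) d
  levelSum-suc h d = trans (sum-map-concatMap h (λ v → map (_∷ v) (allFin p)) (level p d))
    (cong sum (map-cong (λ v → cong sum (sym (map-∘ (allFin p)))) (level p d)))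

  levelSum-subtrees : ∀ h d → levelSum h (suc d) ≡ sum (map (λ i → levelSum (subtree h i) d) (allFin p))
  levelSum-subtrees h zero    = begin
    levelSum h 1                                 ≡⟨ levelSum-suc h 0 ⟩
    childSum h [] + 0                            ≡⟨ +-identityʳ _ ⟩
    childSum h []                                ≡⟨ cong sum (map-cong (λ i → sym (+-identityʳ _)) (allFin p)) ⟩
    sum (map (λ i → levelSum (subtree h i) 0) (allFin p)) ∎
    where open ≡-Reasoning
  levelSum-subtrees h (suc d) = begin
    levelSum h (2 + d)                                              ≡⟨ levelSum-suc h (suc d) ⟩
    levelSum (childSum h) (suc d)                                   ≡⟨ levelSum-subtrees (childSum h) d ⟩
    sum (map (λ i → levelSum (childSum (subtree h i)) d) (allFin p))
      ≡⟨ cong sum (map-cong (λ i → sym (levelSum-suc (subtree h i) d)) (allFin p)) ⟩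
    sum (map (λ i → levelSum (subtree h i) (suc d)) (allFin p))     ∎
    where open ≡-Reasoning

  scalarPartial-suc : ∀ a b n → scalarPartial p a b (suc n) ≡
    a [] * b [] + sum (map (λ i → scalarPartial p (subtree a i) (subtree b i) n) (allFin p))
  scalarPartial-suc a b n = begin
    scalarPartial p a b (suc n)                                         ≡⟨ psum-cons (levelSum ab) n ⟩
    (a [] * b [] + 0) + psum (levelSum ab ∘ suc) n
      ≡⟨ cong₂ _+_ (+-identityʳ _) (psum-cong n (λ d _ → levelSum-subtrees ab d)) ⟩
    a [] * b [] + psum (λ d → sum (map (λ i → levelSum (subtree ab i) d) (allFin p))) n
      ≡⟨ cong (a [] * b [] +_) (psum-sum-map (λ i → levelSum (subtree ab i)) (allFin p) n) ⟩
    a [] * b [] + sum (map (λ i → scalarPartial p (subtree a i) (subtree b i) n) (allFin p)) ∎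
    where
    open ≡-Reasoning
    ab : Vertex p → ℕ
    ab v = a v * b v

  viaChild : Fin p → (ℕ → Fin p) → ℕ → Fin p
  viaChild i t zero    = i
  viaChild i t (suc k) = t k

  pathVertex-viaChild : ∀ i t k → pathVertex (viaChild i t) (suc k) ≡ pathVertex t k ++ i ∷ []
  pathVertex-viaChild i t zero    = refl
  pathVertex-viaChild i t (suc k) = cong (t k ∷_) (pathVertex-viaChild i t k)

  subtree-isIntWeightFunction : ∀ {ω a} → IsIntWeightFunction p ω a → ∀ i →
                                IsIntWeightFunction p (ω ∸ a []) (subtree a i)
  subtree-isIntWeightFunction {ω} {a} wf i = record { pathSum = pathSum′ ; children = children ∘ (_++ i ∷ []) }
    where
    open IsIntWeightFunction wf
    pathSum′ : ∀ t → ∃ λ n → ω ∸ a [] ≤ psum (subtree a i ∘ pathVertex t) n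
    pathSum′ t with pathSum (viaChild i t)
    ... | n , ω≤ = n , m≤n+o⇒m∸n≤o ω (a []) (begin
      ω                                              ≤⟨ ω≤ ⟩
      psum (a ∘ pathVertex (viaChild i t)) n         ≤⟨ psum-monoʳ-≤ (a ∘ pathVertex (viaChild i t)) (n≤1+n n) ⟩
      psum (a ∘ pathVertex (viaChild i t)) (suc n)   ≡⟨ psum-cons (a ∘ pathVertex (viaChild i t)) n ⟩
      a [] + psum (a ∘ pathVertex (viaChild i t) ∘ suc) n
        ≡⟨ cong (a [] +_) (psum-cong n (λ k _ → cong a (pathVertex-viaChild i t k))) ⟩
      a [] + psum (subtree a i ∘ pathVertex t) n     ∎)
      where open ≤-Reasoning

module IntegralBound (p : ℕ) (1<p : 1 < p) where
  open LexMinIntResolution p 1<p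

  descendingChild : ∀ {a} → (∀ v → childSum a v ≤ a v) → ∀ v → ∃ λ i → p * a (i ∷ v) ≤ a v
  descendingChild {a} children v with any? (λ i → p * a (i ∷ v) ≤? a v)
  ... | yes found = found
  ... | no  none  = contradiction (begin-strict
    p * a v                                    <⟨ *-monoʳ-< p (n<1+n (a v)) ⟩
    p * suc (a v)                              ≡⟨ cong (_* suc (a v)) (length-tabulate {n = p} id) ⟨
    length (allFin p) * suc (a v)              ≤⟨ sum-map-≥ _ (allFin p) (λ i → ≰⇒> (none ∘ (i ,_))) ⟩
    sum (map (λ i → p * a (i ∷ v)) (allFin p)) ≡⟨ sum-map-*ˡ p (λ i → a (i ∷ v)) (allFin p) ⟩
    p * childSum a v                           ≤⟨ *-monoʳ-≤ p (children v) ⟩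
    p * a v                                    ∎) (<-irrefl refl)
    where open ≤-Reasoning

  module _ {a : Vertex p → ℕ} (children : ∀ v → childSum a v ≤ a v) where
    descendingVertex : ℕ → Vertex p
    descendingVertex zero    = []
    descendingVertex (suc k) = proj₁ (descendingChild children (descendingVertex k)) ∷ descendingVertex k

    descendingPath : ℕ → Fin p
    descendingPath k = proj₁ (descendingChild children (descendingVertex k))

    descendingVertex-descending : Descending p (a ∘ descendingVertex)
    descendingVertex-descending k = proj₂ (descendingChild children (descendingVertex k))

    pathVertex-descendingPath : ∀ k → pathVertex descendingPath k ≡ descendingVertex k
    pathVertex-descendingPath zero    = refl
    pathVertex-descendingPath (suc k) = cong (descendingPath k ∷_) (pathVertex-descendingPath k)

  γ̂₀≤root : ∀ {ω a} → IsIntWeightFunction p ω a → γ̂₀ ω ≤ a []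
  γ̂₀≤root {ω} {a} record { pathSum = pathSum ; children = children } with pathSum (descendingPath children)
  ... | n , ω≤ = γ̂₀-least ω (begin
    ω                                                 ≤⟨ ω≤ ⟩
    psum (a ∘ pathVertex (descendingPath children)) n
      ≡⟨ psum-cong n (λ k _ → cong a (pathVertex-descendingPath children k)) ⟩
    psum (a ∘ descendingVertex children) n
      ≤⟨ descending-psum≤maxTotal (descendingVertex-descending children) n ⟩
    maxTotal (a [])                                   ∎)
    where open ≤-Reasoning

  γ̂-product : ℕ → ℕ → ℕ → ℕ
  γ̂-product A B = psum (λ i → p ^ i * (γ̂ A i * γ̂ B i))

  γ̂-product-suc : ∀ A B n → γ̂-product A B (suc n) ≡ γ̂₀ A * γ̂₀ B + p * γ̂-product (A ∸ γ̂₀ A) (B ∸ γ̂₀ B) n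
  γ̂-product-suc A B n = trans (psum-cons _ n)
    (cong₂ _+_ (*-identityˡ _) (trans (psum-cong n (λ i _ → *-assoc p (p ^ i) _)) (psum-*ˡ p _ n)))

  γ̂-psum-difference : ∀ {ω ω'} → ω ≤ ω' → ∀ n → psum (λ i → γ̂ ω' i ∸ γ̂ ω i) n ≤ ω' ∸ ω
  γ̂-psum-difference {ω} {ω'} ω≤ω' n = begin
    psum d n         ≤⟨ psum-monoʳ-≤ d (m≤m⊔n n ω') ⟩
    psum d N         ≡⟨ m+n∸m≡n ω (psum d N) ⟨
    ω + psum d N ∸ ω ≡⟨ cong (_∸ ω) total ⟩
    ω' ∸ ω           ∎
    where
    open ≤-Reasoning
    d : ℕ → ℕ
    d i = γ̂ ω' i ∸ γ̂ ω i
    N = n ⊔ ω'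
    total : ω + psum d N ≡ ω'
    total = begin-equality
      ω + psum d N               ≡⟨ cong (_+ psum d N) (γ̂-psum ω N (≤-trans ω≤ω' (m≤n⊔m n ω'))) ⟨
      psum (γ̂ ω) N + psum d N    ≡⟨ psum-+ (γ̂ ω) d N ⟨
      psum (λ i → γ̂ ω i + d i) N ≡⟨ psum-cong N (λ i _ → m+[n∸m]≡n (γ̂-mono i ω≤ω')) ⟩
      psum (γ̂ ω') N              ≡⟨ γ̂-psum ω' N (m≤n⊔m n ω') ⟩
      ω'                         ∎

  γ̂-product-shift : ∀ n {A₁ A₂ B₁ B₂} → A₂ ≤ A₁ → B₂ ≤ B₁ →
    γ̂-product A₁ B₁ n ≤ γ̂-product A₂ B₂ n + γ̂₀ B₁ * (A₁ ∸ A₂) + γ̂₀ A₁ * (B₁ ∸ B₂)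
  γ̂-product-shift n {A₁} {A₂} {B₁} {B₂} A₂≤A₁ B₂≤B₁ = begin
    γ̂-product A₁ B₁ n
      ≤⟨ psum-mono-≤ n (λ i _ → product-exchange (p ^ i) (γ̂₀ B₁) (γ̂₀ A₁) (γ̂-mono i A₂≤A₁) (γ̂-mono i B₂≤B₁)
                                  (descending-pow p (γ̂-descending B₁) 0 i) (descending-pow p (γ̂-descending A₁) 0 i)) ⟩
    psum (λ i → p ^ i * (γ̂ A₂ i * γ̂ B₂ i) + γ̂₀ B₁ * dA i + γ̂₀ A₁ * dB i) n
      ≡⟨ trans (psum-+ _ _ n) (cong (_+ psum (λ i → γ̂₀ A₁ * dB i) n) (psum-+ _ _ n)) ⟩
    γ̂-product A₂ B₂ n + psum (λ i → γ̂₀ B₁ * dA i) n + psum (λ i → γ̂₀ A₁ * dB i) n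
      ≡⟨ cong₂ (λ u v → γ̂-product A₂ B₂ n + u + v) (psum-*ˡ (γ̂₀ B₁) dA n) (psum-*ˡ (γ̂₀ A₁) dB n) ⟩
    γ̂-product A₂ B₂ n + γ̂₀ B₁ * psum dA n + γ̂₀ A₁ * psum dB n
      ≤⟨ +-mono-≤ (+-monoʳ-≤ (γ̂-product A₂ B₂ n) (*-monoʳ-≤ (γ̂₀ B₁) (γ̂-psum-difference A₂≤A₁ n)))
                  (*-monoʳ-≤ (γ̂₀ A₁) (γ̂-psum-difference B₂≤B₁ n)) ⟩
    γ̂-product A₂ B₂ n + γ̂₀ B₁ * (A₁ ∸ A₂) + γ̂₀ A₁ * (B₁ ∸ B₂) ∎
    where
    open ≤-Reasoning
    dA dB : ℕ → ℕ
    dA i = γ̂ A₁ i ∸ γ̂ A₂ i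
    dB i = γ̂ B₁ i ∸ γ̂ B₂ i

  γ̂-product≤scalarPartial : ∀ n {A B a b} → IsIntWeightFunction p A a → IsIntWeightFunction p B b →
                            γ̂-product A B n ≤ scalarPartial p a b n
  γ̂-product≤scalarPartial zero    _ _ = z≤n
  γ̂-product≤scalarPartial (suc n) {A} {B} {a} {b} wa wb = begin
    γ̂-product A B (suc n)                                        ≡⟨ γ̂-product-suc A B n ⟩
    γ̂₀ A * γ̂₀ B + p * γ̂-product (A ∸ γ̂₀ A) (B ∸ γ̂₀ B) n
      ≤⟨ +-monoʳ-≤ (γ̂₀ A * γ̂₀ B) (*-monoʳ-≤ p (γ̂-product-shift n (∸-monoʳ-≤ A gA≤x) (∸-monoʳ-≤ B gB≤y))) ⟩
    γ̂₀ A * γ̂₀ B + p * (F + γ̂₀ (B ∸ γ̂₀ B) * (A ∸ γ̂₀ A ∸ (A ∸ x)) + γ̂₀ (A ∸ γ̂₀ A) * (B ∸ γ̂₀ B ∸ (B ∸ y)))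
      ≤⟨ root-exchange p F gA≤x gB≤y (γ̂₀-remainder B) (γ̂₀-remainder A) (∸-∸-≤ A gA≤x) (∸-∸-≤ B gB≤y) ⟩
    x * y + p * F                                                 ≤⟨ +-monoʳ-≤ (x * y) subtrees ⟩
    x * y + sum (map (λ i → scalarPartial p (subtree p a i) (subtree p b i) n) (allFin p))
                                                                  ≡⟨ scalarPartial-suc p a b n ⟨
    scalarPartial p a b (suc n)                                   ∎
    where
    open ≤-Reasoning
    x = a []
    y = b []
    gA≤x = γ̂₀≤root wa
    gB≤y = γ̂₀≤root wb
    F = γ̂-product (A ∸ x) (B ∸ y) n
    subtrees : p * F ≤ sum (map (λ i → scalarPartial p (subtree p a i) (subtree p b i) n) (allFin p))
    subtrees = begin
      p * F                 ≡⟨ cong (_* F) (length-tabulate {n = p} id) ⟨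
      length (allFin p) * F ≤⟨ sum-map-≥ _ (allFin p) (λ i → γ̂-product≤scalarPartial n
                                 (subtree-isIntWeightFunction p wa i) (subtree-isIntWeightFunction p wb i)) ⟩
      sum (map (λ i → scalarPartial p (subtree p a i) (subtree p b i) n) (allFin p)) ∎

  scalarProduct≥lexMinProduct : ∀ {ωa ωb a b γa γb} → IsIntWeightFunction p ωa a → IsIntWeightFunction p ωb b →
    IsLexMinIntResolution p ωa γa → IsLexMinIntResolution p ωb γb →
    SupGeq (scalarPartial p a b) (psum (λ i → p ^ i * (γa i * γb i)))
  scalarProduct≥lexMinProduct {ωa} {ωb} {a} {b} {γa} {γb} wa wb lexMinA lexMinB n = n , (begin
    psum (λ i → p ^ i * (γa i * γb i)) n
      ≡⟨ psum-cong n (λ i _ → cong₂ (λ u v → p ^ i * (u * v)) (lexMin⇒≡γ̂ lexMinA i) (lexMin⇒≡γ̂ lexMinB i)) ⟩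
    γ̂-product ωa ωb n     ≤⟨ γ̂-product≤scalarPartial n wa wb ⟩
    scalarPartial p a b n ∎)
    where open ≤-Reasoning

-- Repunits

module Repunit (p : ℕ) .{{_ : NonZero p}} where

  repunit : ℕ → ℕ
  repunit zero    = 1
  repunit (suc k) = p ^ suc k + repunit k

  repunit-psum : ∀ k → psum (λ i → p ^ (k ∸ i)) (suc k) ≡ repunit k
  repunit-psum zero    = refl
  repunit-psum (suc k) = trans (psum-cons (λ i → p ^ (suc k ∸ i)) (suc k)) (cong (p ^ suc k +_) (repunit-psum k))

  repunit-pos : ∀ k → 0 < repunit k
  repunit-pos zero    = ℕ.z<s
  repunit-pos (suc k) = <-≤-trans (repunit-pos k) (m≤n+m (repunit k) _)

  repunit-< : ∀ k → repunit k < repunit (suc k)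
  repunit-< k = +-monoˡ-≤ (repunit k) (m^n>0 p (suc k))

  repunit-mono : ∀ {k l} → k ≤ l → repunit k ≤ repunit l
  repunit-mono {l = zero}  z≤n    = ≤-refl
  repunit-mono {k} {suc l} k≤1+l with m≤n⇒m<n∨m≡n k≤1+l
  ... | inj₁ k<1+l = ≤-trans (repunit-mono (≤-pred k<1+l)) (<⇒≤ (repunit-< l))
  ... | inj₂ refl  = ≤-refl

  repunit-bracket : ∀ A → 0 < A → ∃ λ k → repunit k ≤ A × A < repunit (suc k)
  repunit-bracket (suc zero)    _ = 0 , ≤-refl , repunit-< 0
  repunit-bracket (suc (suc A)) _ with repunit-bracket (suc A) ℕ.z<s
  ... | k , lower , upper with m≤n⇒m<n∨m≡n upper
  ...   | inj₁ 2+A<upper = k , m≤n⇒m≤1+n lower , 2+A<upper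
  ...   | inj₂ 2+A≡upper =
    suc k , ≤-reflexive (sym 2+A≡upper) , subst (_< repunit (2 + k)) (sym 2+A≡upper) (repunit-< (suc k))

  pow-split : ∀ {N i} → i ≤ N → p ^ (N ∸ i) * p ^ i ≡ p ^ N
  pow-split {N} {i} i≤N = trans (sym (^-distribˡ-+-* p (N ∸ i) i)) (cong (p ^_) (m∸n+n≡m i≤N))

  descending-repunit : ∀ {γ} → Descending p γ → ∀ i → 0 < γ i → repunit i ≤ psum γ (suc i)
  descending-repunit {γ} γ↓ i 0<γᵢ = begin
    repunit i                          ≡⟨ repunit-psum i ⟨
    psum (λ j → p ^ (i ∸ j)) (suc i)   ≤⟨ psum-mono-≤ (suc i) pow≤γ ⟩
    psum γ (suc i)                     ∎
    where
    open ≤-Reasoning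
    pow≤γ : ∀ j → j < suc i → p ^ (i ∸ j) ≤ γ j
    pow≤γ j j≤i = ≤-trans (m≤m*n (p ^ (i ∸ j)) (γ (j + (i ∸ j))) {{ℕ.>-nonZero 0<γᵢ′}}) (descending-pow p γ↓ j (i ∸ j))
      where
      0<γᵢ′ : 0 < γ (j + (i ∸ j))
      0<γᵢ′ = subst (λ k → 0 < γ k) (sym (m+[n∸m]≡n (≤-pred j≤i))) 0<γᵢ

  resolution-vanishes : ∀ {A γ} → IsIntResolution p A γ → ∀ i → A < repunit i → γ i ≡ 0
  resolution-vanishes {A} {γ} res i A<repunit with γ i in γᵢ≡
  ... | zero  = refl
  ... | suc _ = contradiction (begin-strict
    A              <⟨ A<repunit ⟩
    repunit i      ≤⟨ descending-repunit (IsIntResolution.decreasing res) i (subst (0 <_) (sym γᵢ≡) ℕ.z<s) ⟩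
    psum γ (suc i) ≤⟨ resolution-psum≤ p res (suc i) ⟩
    A              ∎) (<-irrefl refl)
    where open ≤-Reasoning

  chebyshev-resolutions : ∀ N {A B γa γb} → Descending p γa → Descending p γb →
    psum γa (suc N) ≡ A → psum γb (suc N) ≡ B →
    p ^ N * (A * B) ≤ repunit N * psum (λ i → p ^ i * (γa i * γb i)) (suc N)
  chebyshev-resolutions N {A} {B} {γa} {γb} γa↓ γb↓ ΣγA ΣγB = *-cancelˡ-≤ (p ^ N) {{m^n≢0 p N}} (begin
    p ^ N * (p ^ N * (A * B))                                      ≡⟨ square (p ^ N) A B ⟩
    (p ^ N * A) * (p ^ N * B)                                      ≡⟨ cong₂ _*_ (weighted γa ΣγA) (weighted γb ΣγB) ⟩
    psum (λ i → u i * x i) (suc N) * psum (λ i → u i * y i) (suc N)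
      ≤⟨ chebyshev u x y (descending-scaled-antitone p γa↓) (descending-scaled-antitone p γb↓) (suc N) ⟩
    psum u (suc N) * psum (λ i → u i * (x i * y i)) (suc N)        ≡⟨ cong₂ _*_ (repunit-psum N) weightedProduct ⟩
    repunit N * (p ^ N * F)                                        ≡⟨ x∙yz≈y∙xz (repunit N) (p ^ N) F ⟩
    p ^ N * (repunit N * F)                                        ∎)
    where
    open ≤-Reasoning
    u x y : ℕ → ℕ
    u i = p ^ (N ∸ i)
    x i = p ^ i * γa i
    y i = p ^ i * γb i
    F = psum (λ i → p ^ i * (γa i * γb i)) (suc N)
    square : ∀ q a b → q * (q * (a * b)) ≡ (q * a) * (q * b)
    square = solve-∀
    regroup₂ : ∀ r q a b → (r * q) * (q * (a * b)) ≡ r * ((q * a) * (q * b))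
    regroup₂ = solve-∀
    weighted : ∀ γ {C} → psum γ (suc N) ≡ C → p ^ N * C ≡ psum (λ i → u i * (p ^ i * γ i)) (suc N)
    weighted γ {C} Σγ = begin-equality
      p ^ N * C                              ≡⟨ cong (p ^ N *_) Σγ ⟨
      p ^ N * psum γ (suc N)                 ≡⟨ psum-*ˡ (p ^ N) γ (suc N) ⟨
      psum (λ i → p ^ N * γ i) (suc N)
        ≡⟨ psum-cong (suc N) (λ i i≤N →
             trans (cong (_* γ i) (sym (pow-split (≤-pred i≤N)))) (*-assoc (u i) (p ^ i) (γ i))) ⟩
      psum (λ i → u i * (p ^ i * γ i)) (suc N) ∎
    weightedProduct : psum (λ i → u i * (x i * y i)) (suc N) ≡ p ^ N * F
    weightedProduct = begin-equality
      psum (λ i → u i * (x i * y i)) (suc N)                  ≡⟨ psum-cong (suc N) (λ i i≤N →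
           trans (sym (regroup₂ (u i) (p ^ i) (γa i) (γb i))) (cong (_* _) (pow-split (≤-pred i≤N)))) ⟩
      psum (λ i → p ^ N * (p ^ i * (γa i * γb i))) (suc N)    ≡⟨ psum-*ˡ (p ^ N) _ (suc N) ⟩
      p ^ N * F                                               ∎

-- Rational and real resolutions

-- ℚofℕ n = + n / 1 is normalised through a gcd; rewriting it to mkℚ (+ n) 0 _ lets ℚ's operations compute
private
  ℚofℕ≡mkℚ : ∀ n → ℚofℕ n ≡ ℚ.mkℚ (ℤ.+ n) 0 (C.sym (C.1-coprimeTo n))
  ℚofℕ≡mkℚ n = RP.normalize-coprime (C.sym (C.1-coprimeTo n))

ℚofℕ-+ : ∀ m n → ℚofℕ (m + n) ≡ ℚofℕ m ℚ.+ ℚofℕ n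
ℚofℕ-+ m n = trans
  (cong (ℚ._/ 1) (trans (ZP.pos-+ m n) (sym (cong₂ ℤ._+_ (ZP.*-identityʳ (ℤ.+ m)) (ZP.*-identityʳ (ℤ.+ n))))))
  (sym (cong₂ ℚ._+_ (ℚofℕ≡mkℚ m) (ℚofℕ≡mkℚ n)))

ℚofℕ-* : ∀ m n → ℚofℕ (m * n) ≡ ℚofℕ m ℚ.* ℚofℕ n
ℚofℕ-* m n = trans (cong (ℚ._/ 1) (ZP.pos-* m n)) (sym (cong₂ ℚ._*_ (ℚofℕ≡mkℚ m) (ℚofℕ≡mkℚ n)))

ℚofℕ-mono-≤ : ∀ {m n} → m ≤ n → ℚofℕ m ℚ.≤ ℚofℕ n
ℚofℕ-mono-≤ {m} {n} m≤n rewrite ℚofℕ≡mkℚ m | ℚofℕ≡mkℚ n =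
  ℚ.*≤* (subst₂ ℤ._≤_ (sym (ZP.*-identityʳ (ℤ.+ m))) (sym (ZP.*-identityʳ (ℤ.+ n))) (ℤ.+≤+ m≤n))

ℚofℕ-mono-< : ∀ {m n} → m < n → ℚofℕ m ℚ.< ℚofℕ n
ℚofℕ-mono-< {m} {n} m<n rewrite ℚofℕ≡mkℚ m | ℚofℕ≡mkℚ n =
  ℚ.*<* (subst₂ ℤ._<_ (sym (ZP.*-identityʳ (ℤ.+ m))) (sym (ZP.*-identityʳ (ℤ.+ n))) (ℤ.+<+ m<n))

0≤ℚofℕ : ∀ n → 0ℚ ℚ.≤ ℚofℕ n
0≤ℚofℕ n = ℚofℕ-mono-≤ {0} {n} z≤n

*-monoˡ-≤-0≤ : ∀ {c x y} → 0ℚ ℚ.≤ c → x ℚ.≤ y → c ℚ.* x ℚ.≤ c ℚ.* y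
*-monoˡ-≤-0≤ {c} 0≤c = RP.*-monoˡ-≤-nonNeg c {{ℚ.nonNegative 0≤c}}

*-mono-≤-0≤ : ∀ {a b c d} → 0ℚ ℚ.≤ a → a ℚ.≤ b → 0ℚ ℚ.≤ c → c ℚ.≤ d → a ℚ.* c ℚ.≤ b ℚ.* d
*-mono-≤-0≤ {a} {b} {c} 0≤a a≤b 0≤c c≤d =
  RP.≤-trans (RP.*-monoʳ-≤-nonNeg c {{ℚ.nonNegative 0≤c}} a≤b) (*-monoˡ-≤-0≤ (RP.≤-trans 0≤a a≤b) c≤d)

0≤* : ∀ {x y} → 0ℚ ℚ.≤ x → 0ℚ ℚ.≤ y → 0ℚ ℚ.≤ x ℚ.* y
0≤* {x} {y} 0≤x 0≤y = RP.≤-trans (RP.≤-reflexive (sym (RP.*-zeroʳ x))) (*-monoˡ-≤-0≤ 0≤x 0≤y)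

psumℚ-mono-≤ : ∀ {f g} n → (∀ i → i < n → f i ℚ.≤ g i) → psumℚ f n ℚ.≤ psumℚ g n
psumℚ-mono-≤ zero    f≤g = RP.≤-refl
psumℚ-mono-≤ (suc n) f≤g = RP.+-mono-≤ (psumℚ-mono-≤ n (λ i i<n → f≤g i (m<n⇒m<1+n i<n))) (f≤g n ≤-refl)

psumℚ-*ˡ : ∀ c f n → psumℚ (λ i → c ℚ.* f i) n ≡ c ℚ.* psumℚ f n
psumℚ-*ˡ c f zero    = sym (RP.*-zeroʳ c)
psumℚ-*ˡ c f (suc n) = trans (cong (ℚ._+ c ℚ.* f n) (psumℚ-*ˡ c f n)) (sym (RP.*-distribˡ-+ c (psumℚ f n) (f n)))

psumℚ-ℚofℕ : ∀ f n → psumℚ (ℚofℕ ∘ f) n ≡ ℚofℕ (psum f n)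
psumℚ-ℚofℕ f zero    = refl
psumℚ-ℚofℕ f (suc n) = trans (cong (ℚ._+ ℚofℕ (f n)) (psumℚ-ℚofℕ f n)) (sym (ℚofℕ-+ (psum f n) (f n)))

psumℚ-monoʳ-≤ : ∀ {f} → (∀ i → 0ℚ ℚ.≤ f i) → ∀ {m n} → m ≤ n → psumℚ f m ℚ.≤ psumℚ f n
psumℚ-monoʳ-≤ {f} 0≤f {n = zero}  z≤n = RP.≤-refl
psumℚ-monoʳ-≤ {f} 0≤f {m} {suc n} m≤1+n with m≤n⇒m<n∨m≡n m≤1+n
... | inj₁ m<1+n = RP.≤-trans (psumℚ-monoʳ-≤ 0≤f (≤-pred m<1+n))
                           (RP.≤-trans (RP.≤-reflexive (sym (RP.+-identityʳ _))) (RP.+-monoʳ-≤ (psumℚ f n) (0≤f n)))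
... | inj₂ refl  = RP.≤-refl

psumℚ-≤-support : ∀ {f m} → (∀ i → 0ℚ ℚ.≤ f i) → (∀ i → m ≤ i → f i ≡ 0ℚ) → ∀ n → psumℚ f n ℚ.≤ psumℚ f m
psumℚ-≤-support {f} {m} 0≤f f≡0 n with ≤-total n m
... | inj₁ n≤m = psumℚ-monoʳ-≤ 0≤f n≤m
... | inj₂ m≤n = RP.≤-reflexive (stable n m≤n)
  where
  stable : ∀ n → m ≤ n → psumℚ f n ≡ psumℚ f m
  stable zero    z≤n   = refl
  stable (suc n) m≤1+n with m≤n⇒m<n∨m≡n m≤1+n
  ... | inj₁ m<1+n = trans (cong₂ ℚ._+_ (stable n (≤-pred m<1+n)) (f≡0 n (≤-pred m<1+n))) (RP.+-identityʳ _)
  ... | inj₂ refl  = refl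

0<1 : 0ℚ ℚ.< 1ℚ
0<1 = ℚofℕ-mono-< {0} {1} ℕ.z<s

lexLeq⇒head≤ : ∀ {γ δ : ℕ → ℚ.ℚ} → LexLeq ℚ._<_ γ δ → γ 0 ℚ.≤ δ 0
lexLeq⇒head≤ (inj₁ γ≡δ)                = RP.≤-reflexive (γ≡δ 0)
lexLeq⇒head≤ (inj₂ (zero  , _ , γ₀<δ₀)) = RP.<⇒≤ γ₀<δ₀
lexLeq⇒head≤ (inj₂ (suc i , agree , _)) = RP.≤-reflexive (agree 0 ℕ.z<s)

module RealResolution (p : ℕ) .{{_ : NonZero p}} where
  open Repunit p

  module _ {A : ℕ} {γ : ℕ → ℚ.ℚ} (res : IsRealResolution p A γ) where
    open IsRealResolution res

    realResolution-nonNeg : ∀ i → 0ℚ ℚ.≤ γ i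
    realResolution-nonNeg i with values i
    ... | inj₁ γᵢ≡0 = RP.≤-reflexive (sym γᵢ≡0)
    ... | inj₂ 1≤γᵢ = RP.≤-trans (RP.<⇒≤ 0<1) 1≤γᵢ

    realResolution-pow : ∀ j d → ℚofℕ (p ^ d) ℚ.* γ (j + d) ℚ.≤ γ j
    realResolution-pow j zero    = RP.≤-reflexive (trans (RP.*-identityˡ _) (cong γ (+-identityʳ j)))
    realResolution-pow j (suc d) = begin
      ℚofℕ (p * p ^ d) ℚ.* γ (j + suc d)          ≡⟨ cong₂ ℚ._*_ (ℚofℕ-* p (p ^ d)) (cong γ (+-suc j d)) ⟩
      ℚofℕ p ℚ.* ℚofℕ (p ^ d) ℚ.* γ (suc j + d)   ≡⟨ RP.*-assoc (ℚofℕ p) _ _ ⟩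
      ℚofℕ p ℚ.* (ℚofℕ (p ^ d) ℚ.* γ (suc j + d)) ≤⟨ *-monoˡ-≤-0≤ (0≤ℚofℕ p) (realResolution-pow (suc j) d) ⟩
      ℚofℕ p ℚ.* γ (suc j)                        ≤⟨ decreasing j ⟩
      γ j                                         ∎
      where open RP.≤-Reasoning

    realResolution-repunit : ∀ i → 1ℚ ℚ.≤ γ i → ℚofℕ (repunit i) ℚ.≤ psumℚ γ (suc i)
    realResolution-repunit i 1≤γᵢ = begin
      ℚofℕ (repunit i)                                ≡⟨ cong ℚofℕ (repunit-psum i) ⟨
      ℚofℕ (psum (λ j → p ^ (i ∸ j)) (suc i))         ≡⟨ psumℚ-ℚofℕ (λ j → p ^ (i ∸ j)) (suc i) ⟨
      psumℚ (λ j → ℚofℕ (p ^ (i ∸ j))) (suc i)        ≤⟨ psumℚ-mono-≤ (suc i) powᵢ≤γ ⟩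
      psumℚ γ (suc i)                                 ∎
      where
      open RP.≤-Reasoning
      powᵢ≤γ : ∀ j → j < suc i → ℚofℕ (p ^ (i ∸ j)) ℚ.≤ γ j
      powᵢ≤γ j j≤i = begin
        ℚofℕ (p ^ (i ∸ j))                         ≡⟨ RP.*-identityʳ _ ⟨
        ℚofℕ (p ^ (i ∸ j)) ℚ.* 1ℚ                  ≤⟨ *-monoˡ-≤-0≤ (0≤ℚofℕ (p ^ (i ∸ j))) 1≤γᵢ′ ⟩
        ℚofℕ (p ^ (i ∸ j)) ℚ.* γ (j + (i ∸ j))     ≤⟨ realResolution-pow j (i ∸ j) ⟩
        γ j                                        ∎
        where
        1≤γᵢ′ : 1ℚ ℚ.≤ γ (j + (i ∸ j))
        1≤γᵢ′ = subst (λ k → 1ℚ ℚ.≤ γ k) (sym (m+[n∸m]≡n (≤-pred j≤i))) 1≤γᵢ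

    realResolution-vanishes : ∀ i → A < repunit i → γ i ≡ 0ℚ
    realResolution-vanishes i A<repunit with values i
    ... | inj₁ γᵢ≡0 = γᵢ≡0
    ... | inj₂ 1≤γᵢ with sumEq 1ℚ 0<1
    ...   | N , close = contradiction (RP.<-≤-trans (close n (m≤m⊔n N (suc i))) far) (RP.<-irrefl refl)
      where
      open RP.≤-Reasoning
      n = N ⊔ suc i
      S = psumℚ γ n
      1+A≤S : 1ℚ ℚ.+ ℚofℕ A ℚ.≤ S
      1+A≤S = begin
        1ℚ ℚ.+ ℚofℕ A     ≡⟨ ℚofℕ-+ 1 A ⟨
        ℚofℕ (suc A)      ≤⟨ ℚofℕ-mono-≤ A<repunit ⟩
        ℚofℕ (repunit i)  ≤⟨ realResolution-repunit i 1≤γᵢ ⟩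
        psumℚ γ (suc i)   ≤⟨ psumℚ-monoʳ-≤ realResolution-nonNeg (m≤n⊔m N (suc i)) ⟩
        S                 ∎
      1≤S-A : 1ℚ ℚ.≤ S ℚ.- ℚofℕ A
      1≤S-A = begin
        1ℚ                               ≡⟨ RP.+-identityʳ 1ℚ ⟨
        1ℚ ℚ.+ 0ℚ                        ≡⟨ cong (1ℚ ℚ.+_) (RP.+-inverseʳ (ℚofℕ A)) ⟨
        1ℚ ℚ.+ (ℚofℕ A ℚ.- ℚofℕ A)       ≡⟨ RP.+-assoc 1ℚ (ℚofℕ A) (ℚ.- ℚofℕ A) ⟨
        1ℚ ℚ.+ ℚofℕ A ℚ.- ℚofℕ A         ≤⟨ RP.+-monoˡ-≤ (ℚ.- ℚofℕ A) 1+A≤S ⟩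
        S ℚ.- ℚofℕ A                     ∎
      far : 1ℚ ℚ.≤ ℚ.∣ S ℚ.- ℚofℕ A ∣
      far = subst (1ℚ ℚ.≤_) (sym (RP.0≤p⇒∣p∣≡p (RP.≤-trans (RP.<⇒≤ 0<1) 1≤S-A))) 1≤S-A

  module _ (A k : ℕ) where

    scaled : ℕ → ℕ
    scaled i with i ≤? k
    ... | yes _ = A * p ^ (k ∸ i)
    ... | no  _ = 0

    scaled-≤ : ∀ {i} → i ≤ k → scaled i ≡ A * p ^ (k ∸ i)
    scaled-≤ {i} i≤k with i ≤? k
    ... | yes _   = refl
    ... | no  i≰k = contradiction i≤k i≰k

    scaled-> : ∀ {i} → k < i → scaled i ≡ 0
    scaled-> {i} k<i with i ≤? k
    ... | yes i≤k = contradiction i≤k (<⇒≱ k<i)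
    ... | no  _   = refl

    scaled-descending : Descending p scaled
    scaled-descending i with ≤-<-connex (suc i) k
    ... | inj₁ i<k = ≤-reflexive (begin-equality
      p * scaled (suc i)            ≡⟨ cong (p *_) (scaled-≤ i<k) ⟩
      p * (A * p ^ (k ∸ suc i))     ≡⟨ x∙yz≈y∙xz p A _ ⟩
      A * p ^ suc (k ∸ suc i)       ≡⟨ cong (λ e → A * p ^ e) (+-∸-assoc 1 i<k) ⟨
      A * p ^ (k ∸ i)               ≡⟨ scaled-≤ (<⇒≤ i<k) ⟨
      scaled i                      ∎)
      where open ≤-Reasoning
    ... | inj₂ k≤i = ≤-trans (≤-reflexive (trans (cong (p *_) (scaled-> k≤i)) (*-zeroʳ p))) z≤n

    scaled-psum : ∀ {n} → k < n → psum scaled n ≡ A * repunit k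
    scaled-psum {n} k<n = begin
      psum scaled n                           ≡⟨ psum-stable scaled (λ i k<i → scaled-> k<i) k<n ⟩
      psum scaled (suc k)                     ≡⟨ psum-cong (suc k) (λ i i≤k → scaled-≤ (≤-pred i≤k)) ⟩
      psum (λ i → A * p ^ (k ∸ i)) (suc k)    ≡⟨ psum-*ˡ A (λ i → p ^ (k ∸ i)) (suc k) ⟩
      A * psum (λ i → p ^ (k ∸ i)) (suc k)    ≡⟨ cong (A *_) (repunit-psum k) ⟩
      A * repunit k                           ∎
      where open ≡-Reasoning

    private
      r : ℚ.ℚ
      r = ℚofℕ (repunit k)

      0<r : 0ℚ ℚ.< r
      0<r = ℚofℕ-mono-< (repunit-pos k)

      instance
        r>0 : ℚ.Positive r
        r>0 = ℚ.positive 0<r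
        r≢0 : ℚ.NonZero r
        r≢0 = RP.pos⇒nonZero r

      0≤1/r : 0ℚ ℚ.≤ 1/ r
      0≤1/r = RP.nonNegative⁻¹ (1/ r) {{RP.pos⇒nonNeg (1/ r) {{RP.1/pos⇒pos r}}}}

    geometric : ℕ → ℚ.ℚ
    geometric i = 1/ r ℚ.* ℚofℕ (scaled i)

    repunit*geometric : ∀ i → r ℚ.* geometric i ≡ ℚofℕ (scaled i)
    repunit*geometric i = begin
      r ℚ.* (1/ r ℚ.* ℚofℕ (scaled i)) ≡⟨ RP.*-assoc r (1/ r) _ ⟨
      r ℚ.* 1/ r ℚ.* ℚofℕ (scaled i)   ≡⟨ cong (ℚ._* ℚofℕ (scaled i)) (RP.*-inverseʳ r) ⟩
      1ℚ ℚ.* ℚofℕ (scaled i)           ≡⟨ RP.*-identityˡ _ ⟩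
      ℚofℕ (scaled i)                  ∎
      where open ≡-Reasoning

    geometric-values : repunit k ≤ A → ∀ i → geometric i ≡ 0ℚ ⊎ 1ℚ ℚ.≤ geometric i
    geometric-values repunit≤A i with ≤-<-connex i k
    ... | inj₁ i≤k = inj₂ (begin
      1ℚ                     ≡⟨ RP.*-inverseˡ r ⟨
      1/ r ℚ.* r             ≤⟨ *-monoˡ-≤-0≤ 0≤1/r (ℚofℕ-mono-≤ repunit≤scaled) ⟩
      geometric i            ∎)
      where
      open RP.≤-Reasoning
      repunit≤scaled : repunit k ≤ scaled i
      repunit≤scaled = ≤-trans repunit≤A
        (≤-trans (m≤m*n A (p ^ (k ∸ i)) {{m^n≢0 p (k ∸ i)}}) (≤-reflexive (sym (scaled-≤ i≤k))))
    ... | inj₂ k<i = inj₁ (trans (cong (λ s → 1/ r ℚ.* ℚofℕ s) (scaled-> k<i)) (RP.*-zeroʳ (1/ r)))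

    geometric-descending : ∀ i → ℚofℕ p ℚ.* geometric (suc i) ℚ.≤ geometric i
    geometric-descending i = begin
      ℚofℕ p ℚ.* (1/ r ℚ.* ℚofℕ (scaled (suc i))) ≡⟨ ℚ*.x∙yz≈y∙xz (ℚofℕ p) (1/ r) _ ⟩
      1/ r ℚ.* (ℚofℕ p ℚ.* ℚofℕ (scaled (suc i))) ≡⟨ cong (1/ r ℚ.*_) (ℚofℕ-* p (scaled (suc i))) ⟨
      1/ r ℚ.* ℚofℕ (p * scaled (suc i))          ≤⟨ *-monoˡ-≤-0≤ 0≤1/r (ℚofℕ-mono-≤ (scaled-descending i)) ⟩
      geometric i                                 ∎
      where open RP.≤-Reasoning

    geometric-psum : ∀ {n} → k < n → psumℚ geometric n ≡ ℚofℕ A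
    geometric-psum {n} k<n = begin
      psumℚ geometric n                    ≡⟨ psumℚ-*ˡ (1/ r) (ℚofℕ ∘ scaled) n ⟩
      1/ r ℚ.* psumℚ (ℚofℕ ∘ scaled) n     ≡⟨ cong (1/ r ℚ.*_) (psumℚ-ℚofℕ scaled n) ⟩
      1/ r ℚ.* ℚofℕ (psum scaled n)        ≡⟨ cong (λ s → 1/ r ℚ.* ℚofℕ s) (scaled-psum k<n) ⟩
      1/ r ℚ.* ℚofℕ (A * repunit k)        ≡⟨ cong (1/ r ℚ.*_) (ℚofℕ-* A (repunit k)) ⟩
      1/ r ℚ.* (ℚofℕ A ℚ.* r)              ≡⟨ ℚ*.x∙yz≈y∙xz (1/ r) (ℚofℕ A) r ⟩
      ℚofℕ A ℚ.* (1/ r ℚ.* r)              ≡⟨ cong (ℚofℕ A ℚ.*_) (RP.*-inverseˡ r) ⟩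
      ℚofℕ A ℚ.* 1ℚ                        ≡⟨ RP.*-identityʳ (ℚofℕ A) ⟩
      ℚofℕ A                               ∎
      where open ≡-Reasoning

    geometric-isRealResolution : repunit k ≤ A → IsRealResolution p A geometric
    geometric-isRealResolution repunit≤A = record
      { values     = geometric-values repunit≤A
      ; decreasing = geometric-descending
      ; sumEq      = λ ε 0<ε → suc k , λ n k<n →
          subst (ℚ._< ε) (sym (cong ℚ.∣_∣ (trans (cong (ℚ._- ℚofℕ A) (geometric-psum k<n)) (RP.+-inverseʳ (ℚofℕ A))))) 0<ε
      }

  lexMinReal-head-bound : ∀ {A γ} → IsLexMinRealResolution p A γ → ∀ k → repunit k ≤ A →
                          ℚofℕ (repunit k) ℚ.* γ 0 ℚ.≤ ℚofℕ (A * p ^ k)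
  lexMinReal-head-bound {A} {γ} lexMin k repunit≤A = begin
    ℚofℕ (repunit k) ℚ.* γ 0                 ≤⟨ *-monoˡ-≤-0≤ (0≤ℚofℕ (repunit k)) (lexLeq⇒head≤ γ≤geometric) ⟩
    ℚofℕ (repunit k) ℚ.* geometric A k 0     ≡⟨ repunit*geometric A k 0 ⟩
    ℚofℕ (scaled A k 0)                      ≡⟨ cong ℚofℕ (scaled-≤ A k z≤n) ⟩
    ℚofℕ (A * p ^ k)                         ∎
    where
    open RP.≤-Reasoning
    γ≤geometric : LexLeq ℚ._<_ γ (geometric A k)
    γ≤geometric = IsLexMinRealResolution.least lexMin (geometric A k) (geometric-isRealResolution A k repunit≤A)

  lexMinReal-scaled-bound : ∀ {A γ} → IsLexMinRealResolution p A γ → ∀ k → repunit k ≤ A →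
                            ∀ i → ℚofℕ (repunit k) ℚ.* (ℚofℕ (p ^ i) ℚ.* γ i) ℚ.≤ ℚofℕ (A * p ^ k)
  lexMinReal-scaled-bound lexMin k repunit≤A i = RP.≤-trans
    (*-monoˡ-≤-0≤ (0≤ℚofℕ (repunit k)) (realResolution-pow (IsLexMinRealResolution.isRes lexMin) 0 i))
    (lexMinReal-head-bound lexMin k repunit≤A)

module ProductComparison (p : ℕ) .{{_ : NonZero p}}
  {A B : ℕ} {γa γb : ℕ → ℕ} {γa' γb' : ℕ → ℚ.ℚ} (resA : IsIntResolution p A γa) (resB : IsIntResolution p B γb)
  (lexA : IsLexMinRealResolution p A γa') (lexB : IsLexMinRealResolution p B γb') where

  open Repunit p
  open RealResolution p
  open +-*-Solver using (solve; _:*_; _:=_)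

  intTerm : ℕ → ℕ
  intTerm i = p ^ i * (γa i * γb i)

  realTerm : ℕ → ℚ.ℚ
  realTerm i = ℚofℕ (p ^ i) ℚ.* (γa' i ℚ.* γb' i)

  realResA : IsRealResolution p A γa'
  realResA = IsLexMinRealResolution.isRes lexA

  realResB : IsRealResolution p B γb'
  realResB = IsLexMinRealResolution.isRes lexB

  realTerm-nonNeg : ∀ i → 0ℚ ℚ.≤ realTerm i
  realTerm-nonNeg i = 0≤* (0≤ℚofℕ (p ^ i)) (0≤* (realResolution-nonNeg realResA i) (realResolution-nonNeg realResB i))

  realTerm-vanishes : ∀ i → A < repunit i ⊎ B < repunit i → realTerm i ≡ 0ℚ
  realTerm-vanishes i beyond = trans (cong (ℚofℕ (p ^ i) ℚ.*_) (product≡0 beyond)) (RP.*-zeroʳ (ℚofℕ (p ^ i)))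
    where
    product≡0 : A < repunit i ⊎ B < repunit i → γa' i ℚ.* γb' i ≡ 0ℚ
    product≡0 (inj₁ A<repunit) =
      trans (cong (ℚ._* γb' i) (realResolution-vanishes realResA i A<repunit)) (RP.*-zeroˡ (γb' i))
    product≡0 (inj₂ B<repunit) =
      trans (cong (γa' i ℚ.*_) (realResolution-vanishes realResB i B<repunit)) (RP.*-zeroʳ (γa' i))

  realTerm-psum≤ : ∀ m → (∀ i → m ≤ i → A < repunit i ⊎ B < repunit i) → ∀ n → psumℚ realTerm n ℚ.≤ psumℚ realTerm m
  realTerm-psum≤ m beyond = psumℚ-≤-support realTerm-nonNeg (λ i m≤i → realTerm-vanishes i (beyond i m≤i))

  module _ (kA kB : ℕ) (lowerA : repunit kA ≤ A) (upperA : A < repunit (suc kA))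
                   (lowerB : repunit kB ≤ B) (upperB : B < repunit (suc kB)) where
    M N : ℕ
    M = kA ⊓ kB
    N = kA ⊔ kB

    intProduct-bound : p ^ N * (A * B) ≤ repunit N * psum intTerm (suc N)
    intProduct-bound = chebyshev-resolutions N (IsIntResolution.decreasing resA) (IsIntResolution.decreasing resB)
      (resolution-psum-vanishing p resA (suc N) (λ i N<i → resolution-vanishes resA i (beyond upperA (m≤m⊔n kA kB) N<i)))
      (resolution-psum-vanishing p resB (suc N) (λ i N<i → resolution-vanishes resB i (beyond upperB (m≤n⊔m kA kB) N<i)))
      where
      beyond : ∀ {C k i} → C < repunit (suc k) → k ≤ N → N < i → C < repunit i
      beyond C<repunit k≤N N<i = <-≤-trans C<repunit (repunit-mono (≤-<-trans k≤N N<i))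

    D E : ℕ
    D = p ^ M * (repunit kA * repunit kB)
    E = (A * p ^ kA) * (B * p ^ kB)

    E*repunit≤D*intProduct : repunit M * E ≤ D * psum intTerm (suc N)
    E*repunit≤D*intProduct = begin
      repunit M * ((A * p ^ kA) * (B * p ^ kB))             ≡⟨ separate (repunit M) A B (p ^ kA) (p ^ kB) ⟩
      repunit M * (A * B) * (p ^ kA * p ^ kB)               ≡⟨ cong (repunit M * (A * B) *_) (⊓-⊔-* (p ^_) kA kB) ⟨
      repunit M * (A * B) * (p ^ M * p ^ N)                 ≡⟨ regroup (repunit M) (A * B) (p ^ M) (p ^ N) ⟩
      (p ^ M * repunit M) * (p ^ N * (A * B))               ≤⟨ *-monoʳ-≤ (p ^ M * repunit M) intProduct-bound ⟩
      (p ^ M * repunit M) * (repunit N * F)                 ≡⟨ reassociate (p ^ M) (repunit M) (repunit N) F ⟩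
      p ^ M * (repunit M * repunit N) * F                   ≡⟨ cong (λ r → p ^ M * r * F) (⊓-⊔-* repunit kA kB) ⟩
      D * F                                                 ∎
      where
      open ≤-Reasoning
      F = psum intTerm (suc N)
      separate : ∀ r a b x y → r * ((a * x) * (b * y)) ≡ r * (a * b) * (x * y)
      separate = solve-∀
      regroup : ∀ r c x y → r * c * (x * y) ≡ (x * r) * (y * c)
      regroup = solve-∀
      reassociate : ∀ x r s f → (x * r) * (s * f) ≡ x * (r * s) * f
      reassociate = solve-∀

    scaled-realTerm-bound : ∀ i → i ≤ M → ℚofℕ D ℚ.* realTerm i ℚ.≤ ℚofℕ (p ^ (M ∸ i) * E)
    scaled-realTerm-bound i i≤M = begin
      ℚofℕ D ℚ.* realTerm i                          ≡⟨ cong (ℚ._* realTerm i) D≡ ⟩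
      (m ℚ.* P) ℚ.* (RA ℚ.* RB) ℚ.* (P ℚ.* (γa' i ℚ.* γb' i))
        ≡⟨ solve 6 (λ m P RA RB x y → ((m :* P) :* (RA :* RB)) :* (P :* (x :* y)) := m :* ((RA :* (P :* x)) :* (RB :* (P :* y))))
                 refl m P RA RB (γa' i) (γb' i) ⟩
      m ℚ.* (a ℚ.* b)                                ≤⟨ *-monoˡ-≤-0≤ (0≤ℚofℕ (p ^ (M ∸ i))) (*-mono-≤-0≤ 0≤a a≤ 0≤b b≤) ⟩
      m ℚ.* (ℚofℕ (A * p ^ kA) ℚ.* ℚofℕ (B * p ^ kB)) ≡⟨ cong (m ℚ.*_) (ℚofℕ-* (A * p ^ kA) (B * p ^ kB)) ⟨
      m ℚ.* ℚofℕ E                                   ≡⟨ ℚofℕ-* (p ^ (M ∸ i)) E ⟨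
      ℚofℕ (p ^ (M ∸ i) * E)                         ∎
      where
      open RP.≤-Reasoning
      m = ℚofℕ (p ^ (M ∸ i))
      P = ℚofℕ (p ^ i)
      RA = ℚofℕ (repunit kA)
      RB = ℚofℕ (repunit kB)
      a = RA ℚ.* (P ℚ.* γa' i)
      b = RB ℚ.* (P ℚ.* γb' i)
      D≡ : ℚofℕ D ≡ (m ℚ.* P) ℚ.* (RA ℚ.* RB)
      D≡ = trans (ℚofℕ-* (p ^ M) _) (cong₂ ℚ._*_ (trans (cong ℚofℕ (sym (pow-split i≤M))) (ℚofℕ-* (p ^ (M ∸ i)) (p ^ i)))
                                                (ℚofℕ-* (repunit kA) (repunit kB)))
      0≤a : 0ℚ ℚ.≤ a
      0≤a = 0≤* (0≤ℚofℕ (repunit kA)) (0≤* (0≤ℚofℕ (p ^ i)) (realResolution-nonNeg realResA i))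
      0≤b : 0ℚ ℚ.≤ b
      0≤b = 0≤* (0≤ℚofℕ (repunit kB)) (0≤* (0≤ℚofℕ (p ^ i)) (realResolution-nonNeg realResB i))
      a≤ : a ℚ.≤ ℚofℕ (A * p ^ kA)
      a≤ = lexMinReal-scaled-bound lexA kA lowerA i
      b≤ : b ℚ.≤ ℚofℕ (B * p ^ kB)
      b≤ = lexMinReal-scaled-bound lexB kB lowerB i

    realProduct-bound : psumℚ realTerm (suc M) ℚ.≤ ℚofℕ (psum intTerm (suc N))
    realProduct-bound = RP.*-cancelˡ-≤-pos (ℚofℕ D) {{ℚ.positive (ℚofℕ-mono-< 0<D)}} (begin
      ℚofℕ D ℚ.* psumℚ realTerm (suc M)               ≡⟨ psumℚ-*ˡ (ℚofℕ D) realTerm (suc M) ⟨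
      psumℚ (λ i → ℚofℕ D ℚ.* realTerm i) (suc M)     ≤⟨ psumℚ-mono-≤ (suc M) (λ i → scaled-realTerm-bound i ∘ ≤-pred) ⟩
      psumℚ (λ i → ℚofℕ (p ^ (M ∸ i) * E)) (suc M)    ≡⟨ psumℚ-ℚofℕ (λ i → p ^ (M ∸ i) * E) (suc M) ⟩
      ℚofℕ (psum (λ i → p ^ (M ∸ i) * E) (suc M))     ≡⟨ cong ℚofℕ (psum-*ʳ E (λ i → p ^ (M ∸ i)) (suc M)) ⟩
      ℚofℕ (psum (λ i → p ^ (M ∸ i)) (suc M) * E)     ≡⟨ cong (λ r → ℚofℕ (r * E)) (repunit-psum M) ⟩
      ℚofℕ (repunit M * E)                            ≤⟨ ℚofℕ-mono-≤ E*repunit≤D*intProduct ⟩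
      ℚofℕ (D * psum intTerm (suc N))                 ≡⟨ ℚofℕ-* D _ ⟩
      ℚofℕ D ℚ.* ℚofℕ (psum intTerm (suc N))          ∎)
      where
      open RP.≤-Reasoning
      0<D : 0 < D
      0<D = *-mono-≤ (m^n>0 p M) (*-mono-≤ (repunit-pos kA) (repunit-pos kB))

  intProduct≥realProduct : SupGeqℚ (psum intTerm) (psumℚ realTerm)
  intProduct≥realProduct n with 0 <? A | 0 <? B
  ... | no 0≮A | _      = 0 , realTerm-psum≤ 0 (λ i _ → inj₁ (≤-<-trans (≮⇒≥ 0≮A) (repunit-pos i))) n
  ... | yes _  | no 0≮B = 0 , realTerm-psum≤ 0 (λ i _ → inj₂ (≤-<-trans (≮⇒≥ 0≮B) (repunit-pos i))) n
  ... | yes 0<A | yes 0<B with repunit-bracket A 0<A | repunit-bracket B 0<B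
  ...   | kA , lowerA , upperA | kB , lowerB , upperB = suc (kA ⊔ kB) ,
    RP.≤-trans (realTerm-psum≤ (suc (kA ⊓ kB)) beyond n) (realProduct-bound kA kB lowerA upperA lowerB upperB)
    where
    beyond : ∀ i → kA ⊓ kB < i → A < repunit i ⊎ B < repunit i
    beyond i M<i with ≤-total kA kB
    ... | inj₁ kA≤kB = inj₁ (<-≤-trans upperA (repunit-mono (subst (_< i) (m≤n⇒m⊓n≡m kA≤kB) M<i)))
    ... | inj₂ kB≤kA = inj₂ (<-≤-trans upperB (repunit-mono (subst (_< i) (m≥n⇒m⊓n≡n kB≤kA) M<i)))

-- opened only here: the record module of ℚ would clash with the alias ℚ for Data.Rational
open import Data.Rational using (ℚ)

mainTheorem5 :
    (p : ℕ) → Prime p →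
    (a b : Vertex p → ℕ) (ωa ωb : ℕ) →
    IsIntWeightFunction p ωa a → IsIntWeightFunction p ωb b →
    (γa γb : ℕ → ℕ) → IsLexMinIntResolution p ωa γa → IsLexMinIntResolution p ωb γb →
    (γa' γb' : ℕ → ℚ) → IsLexMinRealResolution p ωa γa' → IsLexMinRealResolution p ωb γb' →
    SupGeq (scalarPartial p a b) (psum (λ i → (p ^ i) * (γa i * γb i)))
    × SupGeqℚ (psum (λ i → (p ^ i) * (γa i * γb i)))
              (psumℚ (λ i → ℚofℕ (p ^ i) Data.Rational.* (γa' i Data.Rational.* γb' i)))
mainTheorem5 p p-prime a b ωa ωb wa wb γa γb lexA lexB γa' γb' lexA' lexB' =
  IntegralBound.scalarProduct≥lexMinProduct p (nonTrivial⇒n>1 p) wa wb lexA lexB ,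
  ProductComparison.intProduct≥realProduct p (isRes lexA) (isRes lexB) lexA' lexB'
  where
  open IsLexMinIntResolution using (isRes)
  instance
    nonTrivial : NonTrivial p
    nonTrivial = prime⇒nonTrivial p-prime
    nonZero : NonZero p
    nonZero = nonTrivial⇒nonZero p
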